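{- Let $q=3^k$ with $k$ a positive integer, and let $h(X):=X^3+X^2\in\mathbb{F}_q[X]$. Then an element $\gamma\in\mathbb{F}_q$ has more than one $h$-preimage in $\mathbb{F}_q$ if and only if $\gamma=\delta^2$ for some $\delta\in\mathbb{F}_q$ with $\mathrm{Tr}_{\mathbb{F}_q/\mathbb{F}_3}(\delta)=0$, and (for such $\gamma=\delta^2$) $\gamma$ has three $h$-preimages in $\mathbb{F}_q$ if and only if $\delta\neq 0$. Moreover $|h(\mathbb{F}_q)|=2q/3$, and $S(h)=0$ if $k>2$ while $S(h)=-1$ if $k\le 2$.
   Context: An $h$-preimage of $\gamma$ in $\mathbb{F}_q$ is an $x\in\mathbb{F}_q$ with $h(x)=\gamma$. $h(\mathbb{F}_q)=\{h(x):x\in\mathbb{F}_q\}$ is the value set and $S(h)$ is the sum of its elements (each value counted once). -}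

module Defs where

open import Data.Nat as ℕ using (ℕ; zero; suc)
open import Data.Fin using (Fin)
open import Data.List using (List; map; filter; length; foldr)
open import Data.List as L using ()
open import Data.Product using (Σ; _×_; _,_)
open import Relation.Nullary using (¬_; Dec)
open import Relation.Nullary.Decidable using (¬?)
open import Relation.Binary.PropositionalEquality using (_≡_)
open import Algebra.Structures using (IsCommutativeRing)
open import Function.Bundles using (_⤖_; Bijection)
open import Data.List using (allFin)

record FiniteField (q : ℕ) : Set₁ where
  infixl 7 _*_
  infixl 6 _+_
  field
    Carrier : Set
    _+_ _*_ : Carrier → Carrier → Carrier
    -_      : Carrier → Carrier
    0# 1#   : Carrier
    isCommutativeRing : IsCommutativeRing _≡_ _+_ _*_ -_ 0# 1#
    0≢1     : ¬ (0# ≡ 1#)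
    inverse : ∀ x → ¬ (x ≡ 0#) → Σ Carrier (λ y → x * y ≡ 1#)
    _≟_     : (x y : Carrier) → Dec (x ≡ y)
    enum    : Fin q ⤖ Carrier

  elements : List Carrier
  elements = map (Bijection.to enum) (allFin q)

  _^_ : Carrier → ℕ → Carrier
  x ^ zero  = 1#
  x ^ suc n = x * (x ^ n)

  trace : ℕ → Carrier → Carrier
  trace zero    δ = 0#
  trace (suc i) δ = trace i δ + δ ^ (3 ℕ.^ i)

  h : Carrier → Carrier
  h x = x ^ 3 + x ^ 2

  #preimages : Carrier → ℕ
  #preimages γ = length (filter (λ x → h x ≟ γ) elements)

  valueSet : List Carrier
  valueSet = filter (λ γ → ¬? (#preimages γ ℕ.≟ 0)) elements

  S : Carrier
  S = foldr _+_ 0# valueSet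

module Submission where

-- In characteristic 3 the map ℘(x) = x³ - x is additive with kernel 𝔽₃, so its image has q/3 elements.
-- Since Tr(℘ x) = x^q - x = 0 and the trace is a polynomial of degree q/3, the image of ℘ is exactly
-- the kernel of the trace. For every d, h(X) - ℘(d)² = (X - (d² - d))(X - (d² + d))(X - (d² - 1)),
-- and two distinct preimages x ≠ y of γ force γ = ℘(x - y)²; hence 0 has the two preimages 0 and -1,
-- every ℘(d)² ≠ 0 has three, and every other γ at most one. The preimages of γ beyond the first
-- correspond to the square roots of γ in the image of ℘, so q = |h(𝔽_q)| + q/3, i.e. |h(𝔽_q)| = 2q/3.
-- The same bookkeeping weighted by γ gives S(h) = Σ h(x) - Σ_{δ ∈ ℘(𝔽_q)} δ², and weighting each fibre
-- {d, d + 1, d - 1} of ℘ by -d² turns the last sum into Σ_d -d²℘(d)². So S(h) is a sum of power sums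
-- Σ x^m with m ∈ {2, 3, 4, 6, 8}, which vanish for 0 < m < q - 1, while Σ x^(q-1) = -1; for q = 3,
-- where ℘ vanishes, S(h) = Σ x³ + Σ x² = -1 directly.

open import Defs
open import Data.List using (length)
open import Data.Nat as N using (ℕ)
open import Data.Product using (Σ; _×_)
open import Function.Bundles using (_⇔_)
open import Relation.Nullary using (¬_)
open import Relation.Binary.PropositionalEquality using (_≡_)

open import Algebra.Bundles using (CommutativeMonoid; CommutativeRing; RawRing; Semiring)
import Algebra.Definitions.RawSemiring as RawSemiringDefinitions
import Algebra.Properties.CommutativeMonoid.Sum as CommutativeMonoidSum
import Algebra.Properties.CommutativeSemiring.Exp as CommutativeSemiringExp
import Algebra.Properties.Group as GroupProperties
import Algebra.Properties.Monoid.Mult as MonoidMult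
import Algebra.Properties.Monoid.Mult.TCOptimised as MonoidMultTC
import Algebra.Properties.Ring as RingProperties
import Algebra.Properties.Semiring.Exp as SemiringExp
import Algebra.Properties.Semiring.Mult as SemiringMult
import Algebra.Properties.Semiring.Mult.TCOptimised as SemiringMultTC
import Algebra.Properties.Semiring.Sum as SemiringSum
import Algebra.Solver.Ring as RingSolver
import Algebra.Solver.Ring.AlmostCommutativeRing as ACR
import Algebra.Solver.Ring.NaturalCoefficients.Default as SemiringSolver
open import Algebra.Structures using (IsCommutativeRing)
open import Data.Bool using (T; if_then_else_)
open import Data.Fin as Fin using (Fin; zero; suc)
open import Data.Fin.Permutation using (permutation)
import Data.Fin.Properties as FinP
open import Data.List using (List; []; _∷_; filter; map; foldr; tabulate; allFin; replicate; _++_)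
open import Data.List.Properties using (map-tabulate; length-++; length-replicate)
open import Data.Maybe using (Maybe; just; nothing)
open import Data.Nat using (zero; suc; _≤_; _<_; z≤n; s≤s)
open import Data.Nat.DivMod using (_%_; _/_; m≡m%n+[m/n]*n)
import Data.Nat.Properties as NP
open import Data.Product using (∃; _,_; proj₁; proj₂)
open import Data.Sum as Sum using (_⊎_; inj₁; inj₂; [_,_])
open import Function using (_∘_)
open import Function.Bundles using (_⤖_; Bijection; mk⇔; Equivalence)
open import Relation.Binary.Definitions using (DecidableEquality)
open import Relation.Binary.PropositionalEquality as ≡ using (_≢_; refl; cong; cong₂; sym; trans; subst)
open import Relation.Nullary using (Dec; yes; no; does; contradiction)
open import Relation.Nullary.Decidable using (¬?; _⊎-dec_; _×-dec_)
open import Relation.Unary using (Decidable)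

module EnumeratedSums {C : Set} (_≟_ : DecidableEquality C) {n : ℕ} (enum : Fin n ⤖ C) where

  open Bijection enum using (to; injective; surjective)
  private module ℕSum = CommutativeMonoidSum NP.+-0-commutativeMonoid

  private
    from : C → Fin n
    from x = proj₁ (surjective x)

    to-from : ∀ x → to (from x) ≡ x
    to-from x = proj₂ (surjective x) refl

    from-to : ∀ i → from (to i) ≡ i
    from-to i = injective (to-from (to i))

  ∃? : ∀ {P : C → Set} → Decidable P → Dec (∃ P)
  ∃? {P = P} P? with FinP.any? (P? ∘ to)
  ... | yes (i , pi) = yes (to i , pi)
  ... | no ¬∃ = no λ (x , px) → ¬∃ (from x , ≡.subst P (sym (to-from x)) px)

  𝟙 : ∀ {P : Set} → Dec P → ℕ
  𝟙 d = if does d then 1 else 0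

  count : ∀ {P : C → Set} → Decidable P → ℕ
  count P? = ℕSum.sum (λ i → 𝟙 (P? (to i)))

  𝟙-yes : ∀ {P : Set} (d : Dec P) → P → 𝟙 d ≡ 1
  𝟙-yes (yes _) _ = refl
  𝟙-yes (no ¬p) p = contradiction p ¬p

  𝟙-no : ∀ {P : Set} (d : Dec P) → ¬ P → 𝟙 d ≡ 0
  𝟙-no (yes p) ¬p = contradiction p ¬p
  𝟙-no (no _) _ = refl

  private
    sum-ones : ∀ m → ℕSum.sum {m} (λ _ → 1) ≡ m
    sum-ones zero = refl
    sum-ones (suc m) = cong suc (sum-ones m)

  module Over {c ℓ} (M : CommutativeMonoid c ℓ) where

    open CommutativeMonoid M renaming (refl to ≈-refl; sym to ≈-sym; trans to ≈-trans)
    open CommutativeMonoidSum M using (sum; ∑-comm; ∑-permute; ∑-distrib-+; sum-cong-≋; sum-replicate; sum-replicate-zero)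
    open import Relation.Binary.Reasoning.Setoid setoid

    when : ∀ {P : Set} → Dec P → Carrier → Carrier
    when d x = if does d then x else ε

    when-yes : ∀ {P : Set} (P? : Dec P) → P → ∀ x → when P? x ≈ x
    when-yes (yes _) _ x = ≈-refl
    when-yes (no ¬p) p x = contradiction p ¬p

    when-no : ∀ {P : Set} (P? : Dec P) → ¬ P → ∀ x → when P? x ≈ ε
    when-no (yes p) ¬p x = contradiction p ¬p
    when-no (no _) _ x = ≈-refl

    when-when : ∀ {P Q : Set} (P? : Dec P) (Q? : Dec Q) x → when P? (when Q? x) ≈ when (P? ×-dec Q?) x
    when-when (yes _) (yes _) x = ≈-refl
    when-when (yes _) (no _) x = ≈-refl
    when-when (no _) _ x = ≈-refl

    when-⇔ : ∀ {P Q : Set} → P ⇔ Q → (P? : Dec P) (Q? : Dec Q) →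
             ∀ x → when P? x ≈ when Q? x
    when-⇔ P⇔Q (yes p) (yes q) x = ≈-refl
    when-⇔ P⇔Q (yes p) (no ¬q) x = contradiction (Equivalence.to P⇔Q p) ¬q
    when-⇔ P⇔Q (no ¬p) (yes q) x = contradiction (Equivalence.from P⇔Q q) ¬p
    when-⇔ P⇔Q (no ¬p) (no ¬q) x = ≈-refl

    when-⊎ : ∀ {P Q : Set} → ¬ (P × Q) → (P? : Dec P) (Q? : Dec Q) →
             ∀ x → when (P? ⊎-dec Q?) x ≈ when P? x ∙ when Q? x
    when-⊎ disj (yes p) (yes q) x = contradiction (p , q) disj
    when-⊎ disj (yes p) (no _) x = ≈-sym (identityʳ x)
    when-⊎ disj (no _) (yes q) x = ≈-sym (identityˡ x)
    when-⊎ disj (no _) (no _) x = ≈-sym (identityˡ ε)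

    ∑ : (C → Carrier) → Carrier
    ∑ f = sum (f ∘ to)

    ∑-cong : ∀ {f g : C → Carrier} → (∀ x → f x ≈ g x) → ∑ f ≈ ∑ g
    ∑-cong f≈g = sum-cong-≋ (f≈g ∘ to)

    ∑-distrib : ∀ (f g : C → Carrier) → ∑ (λ x → f x ∙ g x) ≈ ∑ f ∙ ∑ g
    ∑-distrib f g = ∑-distrib-+ (f ∘ to) (g ∘ to)

    ∑-ε : ∑ (λ _ → ε) ≈ ε
    ∑-ε = sum-replicate-zero n

    open MonoidMult monoid using () renaming (_×_ to _·_)

    ∑-const : ∀ c → ∑ (λ _ → c) ≈ n · c
    ∑-const c = sum-replicate n

    ∑-preserves : ∀ {p} (P : Carrier → Set p) → P ε → (∀ {x y} → P x → P y → P (x ∙ y)) →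
                  ∀ {f : C → Carrier} → (∀ x → P (f x)) → P (∑ f)
    ∑-preserves P Pε P∙ {f} Pf = go (f ∘ to) (Pf ∘ to)
      where
      go : ∀ {m} (g : Fin m → Carrier) → (∀ i → P (g i)) → P (sum g)
      go {zero} g Pg = Pε
      go {suc m} g Pg = P∙ (Pg zero) (go (g ∘ suc) (Pg ∘ suc))

    ∑-when-const : ∀ {P : C → Set} (P? : Decidable P) c → ∑ (λ x → when (P? x) c) ≈ count P? · c
    ∑-when-const P? c = go to
      where
      go : ∀ {m} (f : Fin m → C) → sum (λ i → when (P? (f i)) c) ≈ ℕSum.sum (λ i → 𝟙 (P? (f i))) · c
      go {zero} f = ≈-refl
      go {suc m} f with P? (f zero)
      ... | yes _ = ∙-congˡ (go (f ∘ suc))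
      ... | no _ = ≈-trans (identityˡ _) (go (f ∘ suc))

    ∑-when-⊥ : ∀ {P : C → Set} (P? : Decidable P) (v : C → Carrier) →
               (∀ x → ¬ P x) → ∑ (λ x → when (P? x) (v x)) ≈ ε
    ∑-when-⊥ P? v ¬P = ≈-trans (∑-cong vanish) ∑-ε
      where
      vanish : ∀ x → when (P? x) (v x) ≈ ε
      vanish x with P? x
      ... | yes px = contradiction px (¬P x)
      ... | no _ = ≈-refl

    ∑-when-⇔ : ∀ {P Q : C → Set} (P? : Decidable P) (Q? : Decidable Q) →
               (∀ x → P x ⇔ Q x) → ∀ (v : C → Carrier) →
               ∑ (λ x → when (P? x) (v x)) ≈ ∑ (λ x → when (Q? x) (v x))
    ∑-when-⇔ P? Q? P⇔Q v = ∑-cong λ x → when-⇔ (P⇔Q x) (P? x) (Q? x) (v x)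

    ∑-when-⊎ : ∀ {P Q : C → Set} (P? : Decidable P) (Q? : Decidable Q) →
               (∀ x → ¬ (P x × Q x)) → ∀ (v : C → Carrier) →
               ∑ (λ x → when (P? x ⊎-dec Q? x) (v x)) ≈
               ∑ (λ x → when (P? x) (v x)) ∙ ∑ (λ x → when (Q? x) (v x))
    ∑-when-⊎ P? Q? disj v = ≈-trans (∑-cong λ x → when-⊎ (disj x) (P? x) (Q? x) (v x))
                                    (∑-distrib (λ x → when (P? x) (v x)) (λ x → when (Q? x) (v x)))

    private
      sum-when-≡ : ∀ {m} (i : Fin m) (w : Fin m → Carrier) → sum (λ j → when (j Fin.≟ i) (w j)) ≈ w i
      sum-when-≡ {suc m} zero w = begin
        w zero ∙ sum (λ j → when (suc j Fin.≟ zero) (w (suc j))) ≡⟨⟩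
        w zero ∙ sum (λ (_ : Fin m) → ε)                       ≈⟨ ∙-congˡ (sum-replicate-zero m) ⟩
        w zero ∙ ε                                             ≈⟨ identityʳ _ ⟩
        w zero                                                 ∎
      sum-when-≡ {suc m} (suc i) w = begin
        ε ∙ sum (λ j → when (suc j Fin.≟ suc i) (w (suc j))) ≈⟨ identityˡ _ ⟩
        sum (λ j → when (suc j Fin.≟ suc i) (w (suc j)))     ≈⟨ sum-cong-≋ (λ j → when-⇔ suc-≡⇔ (suc j Fin.≟ suc i) (j Fin.≟ i) (w (suc j))) ⟩
        sum (λ j → when (j Fin.≟ i) (w (suc j)))             ≈⟨ sum-when-≡ i (w ∘ suc) ⟩
        w (suc i)                                            ∎
        where
        suc-≡⇔ : ∀ {j} → (Fin.suc {m} j ≡ suc i) ⇔ (j ≡ i)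
        suc-≡⇔ = mk⇔ FinP.suc-injective (cong suc)

    ∑-when-≡ : ∀ a (v : C → Carrier) → ∑ (λ x → when (x ≟ a) (v x)) ≈ v a
    ∑-when-≡ a v = begin
      ∑ (λ x → when (x ≟ a) (v x))                 ≈⟨ sum-cong-≋ (λ i → when-⇔ to≡⇔ (to i ≟ a) (i Fin.≟ from a) (v (to i))) ⟩
      sum (λ i → when (i Fin.≟ from a) (v (to i))) ≈⟨ sum-when-≡ (from a) (v ∘ to) ⟩
      v (to (from a))                              ≡⟨ cong v (to-from a) ⟩
      v a                                          ∎
      where
      to≡⇔ : ∀ {i} → (to i ≡ a) ⇔ (i ≡ from a)
      to≡⇔ {i} = mk⇔ (λ e → trans (sym (from-to i)) (cong from e)) (λ e → trans (cong to e) (to-from a))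

    ∑-fibres : ∀ (f : C → C) (H : C → C → Carrier) →
               ∑ (λ x → H x (f x)) ≈ ∑ (λ y → ∑ (λ x → when (f x ≟ y) (H x y)))
    ∑-fibres f H = begin
      ∑ (λ x → H x (f x))                                        ≈⟨ ∑-cong (λ x → ≈-sym (∑-when-≡ (f x) (H x))) ⟩
      sum (λ i → sum (λ j → when (to j ≟ f (to i)) (H (to i) (to j))))
                                                                 ≈⟨ ∑-comm (λ i j → when (to j ≟ f (to i)) (H (to i) (to j))) ⟩
      sum (λ j → sum (λ i → when (to j ≟ f (to i)) (H (to i) (to j))))
                                                                 ≈⟨ sum-cong-≋ (λ j → ∑-cong (λ x → when-⇔ sym⇔ (to j ≟ f x) (f x ≟ to j) (H x (to j)))) ⟩
      ∑ (λ y → ∑ (λ x → when (f x ≟ y) (H x y)))                 ∎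
      where
      sym⇔ : ∀ {a b : C} → (a ≡ b) ⇔ (b ≡ a)
      sym⇔ = mk⇔ sym sym

    ∑-reindex : ∀ (σ τ : C → C) → (∀ x → σ (τ x) ≡ x) → (∀ x → τ (σ x) ≡ x) →
                ∀ g → ∑ (λ x → g (σ x)) ≈ ∑ g
    ∑-reindex σ τ στ τσ g = begin
      ∑ (λ x → g (σ x))          ≈⟨ ∑-cong (λ x → reflexive (cong g (sym (to-from (σ x))))) ⟩
      sum (λ i → g (to (π i)))   ≈⟨ ≈-sym (∑-permute (g ∘ to) permutation-σ) ⟩
      ∑ g                        ∎
      where
      π : Fin n → Fin n
      π i = from (σ (to i))
      conjugate : ∀ (ρ ρ' : C → C) → (∀ x → ρ (ρ' x) ≡ x) →
                  ∀ i → from (ρ (to (from (ρ' (to i))))) ≡ i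
      conjugate ρ ρ' ρρ' i = trans (cong (from ∘ ρ) (to-from _)) (trans (cong from (ρρ' _)) (from-to i))
      permutation-σ = permutation π (λ i → from (τ (to i))) (conjugate σ τ στ) (conjugate τ σ τσ)

    foldr-filter : ∀ {P : C → Set} (P? : Decidable P) (v : C → Carrier) →
                   foldr (λ x acc → v x ∙ acc) ε (filter P? (map to (allFin n))) ≈ ∑ (λ x → when (P? x) (v x))
    foldr-filter P? v = ≈-trans (reflexive (cong (foldr (λ x acc → v x ∙ acc) ε ∘ filter P?) (map-tabulate (λ i → i) to)))
                              (tabulate-filter to)
      where
      tabulate-filter : ∀ {m} (f : Fin m → C) →
                        foldr (λ x acc → v x ∙ acc) ε (filter P? (tabulate f)) ≈ sum (λ i → when (P? (f i)) (v (f i)))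
      tabulate-filter {zero} f = ≈-refl
      tabulate-filter {suc m} f with P? (f zero)
      ... | yes _ = ∙-congˡ (tabulate-filter (f ∘ suc))
      ... | no _ = ≈-trans (tabulate-filter (f ∘ suc)) (≈-sym (identityˡ _))

  module ℕΣ = Over NP.+-0-commutativeMonoid

  ℕΣ-*ˡ : ∀ c (g : C → ℕ) → ℕΣ.∑ (λ y → c N.* g y) ≡ c N.* ℕΣ.∑ g
  ℕΣ-*ˡ c g = sym (*-distribˡ-sum c (g ∘ to))
    where open SemiringSum NP.+-*-semiring using (*-distribˡ-sum)

  count-fibres : ∀ {P : C → Set} (P? : Decidable P) (f : C → C) →
                 count P? ≡ ℕΣ.∑ (λ y → count (λ x → (f x ≟ y) ×-dec P? x))
  count-fibres P? f = trans (ℕΣ.∑-fibres f (λ x _ → 𝟙 (P? x)))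
                            (ℕΣ.∑-cong λ y → ℕΣ.∑-cong λ x → ℕΣ.when-when (f x ≟ y) (P? x) 1)

  fibres-partition : ∀ (f : C → C) → ℕΣ.∑ (λ y → count (λ x → f x ≟ y)) ≡ n
  fibres-partition f = trans (sym (ℕΣ.∑-fibres f (λ _ _ → 1))) (sum-ones n)

  count-⇔ : ∀ {P Q : C → Set} (P? : Decidable P) (Q? : Decidable Q) →
            (∀ x → P x ⇔ Q x) → count P? ≡ count Q?
  count-⇔ P? Q? P⇔Q = ℕΣ.∑-when-⇔ P? Q? P⇔Q (λ _ → 1)

  count-⊎ : ∀ {P Q : C → Set} (P? : Decidable P) (Q? : Decidable Q) →
            (∀ x → ¬ (P x × Q x)) → count (λ x → P? x ⊎-dec Q? x) ≡ count P? N.+ count Q?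
  count-⊎ P? Q? disj = ℕΣ.∑-when-⊎ P? Q? disj (λ _ → 1)

  count-⊥ : ∀ {P : C → Set} (P? : Decidable P) → (∀ x → ¬ P x) → count P? ≡ 0
  count-⊥ P? ¬P = ℕΣ.∑-when-⊥ P? (λ _ → 1) ¬P

  count-≡ : ∀ a → count (_≟ a) ≡ 1
  count-≡ a = ℕΣ.∑-when-≡ a (λ _ → 1)

  count-compl : ∀ {P : C → Set} (P? : Decidable P) → count P? N.+ count (¬? ∘ P?) ≡ n
  count-compl P? = trans (sym (ℕSum.∑-distrib-+ (λ i → 𝟙 (P? (to i))) (λ i → 𝟙 (¬? (P? (to i))))))
                         (trans (ℕSum.sum-cong-≗ (λ i → 𝟙+𝟙¬ (P? (to i)))) (sum-ones n))
    where
    𝟙+𝟙¬ : ∀ {P : Set} (d : Dec P) → 𝟙 d N.+ 𝟙 (¬? d) ≡ 1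
    𝟙+𝟙¬ (yes _) = refl
    𝟙+𝟙¬ (no _) = refl

  count-mono : ∀ {P Q : C → Set} (P? : Decidable P) (Q? : Decidable Q) →
               (∀ {x} → P x → Q x) → count P? ≤ count Q?
  count-mono {P = P} {Q} P? Q? P⊆Q = ≡.subst (count P? ≤_) (sym split) (NP.m≤m+n (count P?) _)
    where
    split : count Q? ≡ count P? N.+ count (λ x → Q? x ×-dec ¬? (P? x))
    split = trans (count-⇔ Q? (λ x → P? x ⊎-dec (Q? x ×-dec ¬? (P? x))) Q⇔)
                  (count-⊎ P? (λ x → Q? x ×-dec ¬? (P? x)) λ x (px , _ , ¬px) → ¬px px)
      where
      Q⇔ : ∀ x → Q x ⇔ (P x ⊎ (Q x × ¬ P x))
      Q⇔ x with P? x
      ... | yes px = mk⇔ (λ _ → inj₁ px) (λ _ → P⊆Q px)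
      ... | no ¬px = mk⇔ (λ qx → inj₂ (qx , ¬px)) λ { (inj₁ px) → P⊆Q px ; (inj₂ (qx , _)) → qx }

  count-∪ : ∀ {P Q R : C → Set}
            (P? : Decidable P) (Q? : Decidable Q) (R? : Decidable R) →
            (∀ {x} → P x → Q x ⊎ R x) → count P? ≤ count Q? N.+ count R?
  count-∪ {P = P} {Q} {R} P? Q? R? P⊆Q∪R = begin
    count P?                                                  ≤⟨ count-mono P? Q∪R∖Q? P⊆ ⟩
    count Q∪R∖Q?                                              ≡⟨ count-⊎ Q? R∖Q? (λ x (qx , _ , ¬qx) → ¬qx qx) ⟩
    count Q? N.+ count R∖Q?                                   ≤⟨ NP.+-monoʳ-≤ (count Q?) (count-mono R∖Q? R? proj₁) ⟩
    count Q? N.+ count R?                                     ∎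
    where
    open NP.≤-Reasoning
    R∖Q? = λ x → R? x ×-dec ¬? (Q? x)
    Q∪R∖Q? = λ x → Q? x ⊎-dec R∖Q? x
    P⊆ : ∀ {x} → P x → Q x ⊎ (R x × ¬ Q x)
    P⊆ {x} px with Q? x | P⊆Q∪R px
    ... | yes qx | _ = inj₁ qx
    ... | no _ | inj₁ qx = inj₁ qx
    ... | no ¬qx | inj₂ rx = inj₂ (rx , ¬qx)

  count≢0⇒∃ : ∀ {P : C → Set} (P? : Decidable P) → count P? ≢ 0 → ∃ P
  count≢0⇒∃ P? count≢0 with ∃? P?
  ... | yes ∃P = ∃P
  ... | no ¬∃P = contradiction (count-⊥ P? λ x px → ¬∃P (x , px)) count≢0

  count<size⇒∃¬ : ∀ {P : C → Set} (P? : Decidable P) → count P? < n → ∃ (¬_ ∘ P)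
  count<size⇒∃¬ P? count<n = count≢0⇒∃ (¬? ∘ P?) λ count≡0 →
    NP.<-irrefl (trans (sym (NP.+-identityʳ _)) (trans (cong (count P? N.+_) (sym count≡0)) (count-compl P?))) count<n

  count-remove : ∀ {P : C → Set} (P? : Decidable P) {a} → P a →
                 count P? ≡ 1 N.+ count (λ x → P? x ×-dec ¬? (x ≟ a))
  count-remove {P = P} P? {a} pa =
    trans (count-⇔ P? (λ x → (x ≟ a) ⊎-dec P∖a? x) P⇔)
          (trans (count-⊎ (_≟ a) P∖a? λ x (x≡a , _ , x≢a) → x≢a x≡a) (cong (N._+ count P∖a?) (count-≡ a)))
    where
    P∖a? = λ x → P? x ×-dec ¬? (x ≟ a)
    P⇔ : ∀ x → P x ⇔ (x ≡ a ⊎ (P x × x ≢ a))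
    P⇔ x with x ≟ a
    ... | yes refl = mk⇔ (λ _ → inj₁ refl) (λ _ → pa)
    ... | no x≢a = mk⇔ (λ px → inj₂ (px , x≢a)) λ { (inj₁ x≡a) → contradiction x≡a x≢a ; (inj₂ (px , _)) → px }

  1<count⇒distinct : ∀ {P : C → Set} (P? : Decidable P) → 1 < count P? →
                     Σ C λ x → Σ C λ y → x ≢ y × P x × P y
  1<count⇒distinct P? 1<count with count≢0⇒∃ P? (λ e → NP.<⇒≢ (NP.<-trans (s≤s z≤n) 1<count) (sym e))
  ... | x , px with count≢0⇒∃ (λ y → P? y ×-dec ¬? (y ≟ x))
                     (λ e → NP.<-irrefl (sym (trans (count-remove P? px) (cong (1 N.+_) e))) 1<count)
  ... | y , py , y≢x = x , y , (λ x≡y → y≢x (sym x≡y)) , px , py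

  count-pair : ∀ {P : C → Set} (P? : Decidable P) {a b} → a ≢ b →
               (∀ x → P x ⇔ (x ≡ a ⊎ x ≡ b)) → count P? ≡ 2
  count-pair P? {a} {b} a≢b P⇔ =
    trans (count-⇔ P? (λ x → (x ≟ a) ⊎-dec (x ≟ b)) P⇔)
          (trans (count-⊎ (_≟ a) (_≟ b) (λ x (x≡a , x≡b) → a≢b (trans (sym x≡a) x≡b)))
                 (cong₂ N._+_ (count-≡ a) (count-≡ b)))

  count-triple : ∀ {P : C → Set} (P? : Decidable P) {a b c} → a ≢ b → a ≢ c → b ≢ c →
                 (∀ x → P x ⇔ (x ≡ a ⊎ x ≡ b ⊎ x ≡ c)) → count P? ≡ 3
  count-triple P? {a} {b} {c} a≢b a≢c b≢c P⇔ =
    trans (count-⇔ P? (λ x → (x ≟ a) ⊎-dec ((x ≟ b) ⊎-dec (x ≟ c))) P⇔)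
          (trans (count-⊎ (_≟ a) (λ x → (x ≟ b) ⊎-dec (x ≟ c)) a∉bc)
                 (cong₂ N._+_ (count-≡ a) (count-pair (λ x → (x ≟ b) ⊎-dec (x ≟ c)) b≢c (λ x → mk⇔ (λ p → p) (λ p → p)))))
    where
    a∉bc : ∀ x → ¬ (x ≡ a × (x ≡ b ⊎ x ≡ c))
    a∉bc x (x≡a , inj₁ x≡b) = a≢b (trans (sym x≡a) x≡b)
    a∉bc x (x≡a , inj₂ x≡c) = a≢c (trans (sym x≡a) x≡c)

  length-filter : ∀ {P : C → Set} (P? : Decidable P) → length (filter P? (map to (allFin n))) ≡ count P?
  length-filter P? = ℕΣ.foldr-filter P? (λ _ → 1)

module FieldTheory {q : ℕ} (F : FiniteField q) where

  open FiniteField F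
  open IsCommutativeRing isCommutativeRing public
    using (+-assoc; +-comm; *-assoc; *-comm; +-identityˡ; +-identityʳ; *-identityˡ; *-identityʳ;
           -‿inverseˡ; -‿inverseʳ; zeroˡ; zeroʳ)
  open ≡.≡-Reasoning

  ring : CommutativeRing _ _
  ring = record { isCommutativeRing = isCommutativeRing }

  open CommutativeRing ring public using (_-_; +-commutativeMonoid; *-commutativeMonoid; commutativeSemiring; semiring)
  open GroupProperties (CommutativeRing.+-group ring) public
    using (x∙y⁻¹≈ε⇒x≈y; x≈y⇒x∙y⁻¹≈ε; identityʳ-unique; inverseˡ-unique; inverseʳ-unique; ⁻¹-injective; ε⁻¹≈ε)
  open SemiringMult semiring public using (×1-homo-*; ×-homo-+) renaming (_×_ to _·_)
  open RawSemiringDefinitions (Semiring.rawSemiring semiring) using () renaming (_^_ to _^ₛ_)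
  open SemiringExp semiring using (^-assocʳ)
  open CommutativeSemiringExp commutativeSemiring using (^-distrib-*)
  open RingProperties (CommutativeRing.ring ring) using ([y-z]x≈yx-zx)
  open SemiringSum semiring using (*-distribˡ-sum)
  open SemiringSolver commutativeSemiring using (solve; _:=_; _:+_; _:*_; con)

  open EnumeratedSums _≟_ enum public
  open Over +-commutativeMonoid public
  module ∏ = Over *-commutativeMonoid

  ^≡^ₛ : ∀ x n → x ^ n ≡ x ^ₛ n
  ^≡^ₛ x zero = refl
  ^≡^ₛ x (suc n) = cong (x *_) (^≡^ₛ x n)

  ^-* : ∀ x m n → (x ^ m) ^ n ≡ x ^ (m N.* n)
  ^-* x m n = begin
    (x ^ m) ^ n      ≡⟨ trans (^≡^ₛ (x ^ m) n) (cong (_^ₛ n) (^≡^ₛ x m)) ⟩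
    (x ^ₛ m) ^ₛ n    ≡⟨ ^-assocʳ x m n ⟩
    x ^ₛ (m N.* n)   ≡⟨ sym (^≡^ₛ x (m N.* n)) ⟩
    x ^ (m N.* n)    ∎

  *-^ : ∀ x y n → (x * y) ^ n ≡ x ^ n * y ^ n
  *-^ x y n = trans (^≡^ₛ (x * y) n) (trans (^-distrib-* x y n) (sym (cong₂ _*_ (^≡^ₛ x n) (^≡^ₛ y n))))

  *-∑ : ∀ c f → c * ∑ f ≡ ∑ (λ x → c * f x)
  *-∑ c f = *-distribˡ-sum c (f ∘ Bijection.to enum)

  ∑-neg : ∀ f → ∑ (λ x → - f x) ≡ - ∑ f
  ∑-neg f = inverseˡ-unique (∑ (λ x → - f x)) (∑ f) (begin
    ∑ (λ x → - f x) + ∑ f       ≡⟨ sym (∑-distrib (λ x → - f x) f) ⟩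
    ∑ (λ x → - f x + f x)       ≡⟨ ∑-cong (λ x → -‿inverseˡ (f x)) ⟩
    ∑ (λ _ → 0#)                ≡⟨ ∑-ε ⟩
    0#                          ∎)

  x-y≡0⇒x≡y : ∀ {x y} → x - y ≡ 0# → x ≡ y
  x-y≡0⇒x≡y = x∙y⁻¹≈ε⇒x≈y _ _

  x≡y⇒x-y≡0 : ∀ {x y} → x ≡ y → x - y ≡ 0#
  x≡y⇒x-y≡0 = x≈y⇒x∙y⁻¹≈ε

  x-y≡z≢0⇒x≢y : ∀ {x y z} → x - y ≡ z → z ≢ 0# → x ≢ y
  x-y≡z≢0⇒x≢y x-y≡z z≢0 x≡y = z≢0 (trans (sym x-y≡z) (x≡y⇒x-y≡0 x≡y))

  x+y≡0⇒x≡-y : ∀ {x y} → x + y ≡ 0# → x ≡ - y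
  x+y≡0⇒x≡-y = inverseˡ-unique _ _

  -x≡0⇒x≡0 : ∀ {x} → - x ≡ 0# → x ≡ 0#
  -x≡0⇒x≡0 -x≡0 = ⁻¹-injective (trans -x≡0 (sym ε⁻¹≈ε))

  1≢0 : 1# ≢ 0#
  1≢0 e = 0≢1 (sym e)

  x≢0⇒x*y≡0⇒y≡0 : ∀ {x y} → x ≢ 0# → x * y ≡ 0# → y ≡ 0#
  x≢0⇒x*y≡0⇒y≡0 {x} {y} x≢0 xy≡0 with inverse x x≢0
  ... | x⁻¹ , xx⁻¹≡1 = begin
    y               ≡⟨ sym (*-identityˡ y) ⟩
    1# * y          ≡⟨ cong (_* y) (trans (sym xx⁻¹≡1) (*-comm x x⁻¹)) ⟩
    (x⁻¹ * x) * y   ≡⟨ *-assoc x⁻¹ x y ⟩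
    x⁻¹ * (x * y)   ≡⟨ cong (x⁻¹ *_) xy≡0 ⟩
    x⁻¹ * 0#        ≡⟨ zeroʳ x⁻¹ ⟩
    0#              ∎

  x*y≡0⇒x≡0⊎y≡0 : ∀ {x y} → x * y ≡ 0# → x ≡ 0# ⊎ y ≡ 0#
  x*y≡0⇒x≡0⊎y≡0 {x} xy≡0 with x ≟ 0#
  ... | yes x≡0 = inj₁ x≡0
  ... | no x≢0 = inj₂ (x≢0⇒x*y≡0⇒y≡0 x≢0 xy≡0)

  x^n≡0⇒x≡0 : ∀ {x} n → x ^ n ≡ 0# → x ≡ 0#
  x^n≡0⇒x≡0 zero 1≡0 = contradiction 1≡0 1≢0
  x^n≡0⇒x≡0 (suc n) xxⁿ≡0 with x*y≡0⇒x≡0⊎y≡0 xxⁿ≡0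
  ... | inj₁ x≡0 = x≡0
  ... | inj₂ xⁿ≡0 = x^n≡0⇒x≡0 n xⁿ≡0

  characteristic : q · 1# ≡ 0#
  characteristic = identityʳ-unique (∑ (λ x → x)) (q · 1#) (begin
    ∑ (λ x → x) + q · 1#             ≡⟨ cong (∑ (λ x → x) +_) (sym (∑-const 1#)) ⟩
    ∑ (λ x → x) + ∑ (λ _ → 1#)       ≡⟨ sym (∑-distrib (λ x → x) (λ _ → 1#)) ⟩
    ∑ (λ x → x + 1#)                 ≡⟨ ∑-reindex (_+ 1#) (_- 1#) [x-1]+1≡x [x+1]-1≡x (λ x → x) ⟩
    ∑ (λ x → x)                      ∎)
    where
    [x-1]+1≡x : ∀ x → (x - 1#) + 1# ≡ x
    [x-1]+1≡x x = trans (+-assoc x (- 1#) 1#) (trans (cong (x +_) (-‿inverseˡ 1#)) (+-identityʳ x))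
    [x+1]-1≡x : ∀ x → (x + 1#) - 1# ≡ x
    [x+1]-1≡x x = trans (+-assoc x 1# (- 1#)) (trans (cong (x +_) (-‿inverseʳ 1#)) (+-identityʳ x))

  x*y≡y⇒x≡1⊎y≡0 : ∀ {x y} → x * y ≡ y → x ≡ 1# ⊎ y ≡ 0#
  x*y≡y⇒x≡1⊎y≡0 {x} {y} xy≡y with x*y≡0⇒x≡0⊎y≡0 (begin
    (x - 1#) * y      ≡⟨ [y-z]x≈yx-zx y x 1# ⟩
    x * y - 1# * y    ≡⟨ cong (λ z → x * y - z) (*-identityˡ y) ⟩
    x * y - y         ≡⟨ x≡y⇒x-y≡0 xy≡y ⟩
    0#                ∎)
  ... | inj₁ x-1≡0 = inj₁ (x-y≡0⇒x≡y x-1≡0)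
  ... | inj₂ y≡0 = inj₂ y≡0

  module _ {a : Carrier} (a≢0 : a ≢ 0#) where

    private
      a⁻¹ : Carrier
      a⁻¹ = proj₁ (inverse a a≢0)

      aa⁻¹≡1 : a * a⁻¹ ≡ 1#
      aa⁻¹≡1 = proj₂ (inverse a a≢0)

      b*[c*x]≡x : ∀ b c → b * c ≡ 1# → ∀ x → b * (c * x) ≡ x
      b*[c*x]≡x b c bc≡1 x = trans (sym (*-assoc b c x)) (trans (cong (_* x) bc≡1) (*-identityˡ x))

      a⁻¹a≡1 : a⁻¹ * a ≡ 1#
      a⁻¹a≡1 = trans (*-comm a⁻¹ a) aa⁻¹≡1

    ∑-scale : ∀ g → ∑ (λ x → g (a * x)) ≡ ∑ g
    ∑-scale = ∑-reindex (a *_) (a⁻¹ *_) (b*[c*x]≡x a a⁻¹ aa⁻¹≡1) (b*[c*x]≡x a⁻¹ a a⁻¹a≡1)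

    ∏-scale : ∀ g → ∏.∑ (λ x → g (a * x)) ≡ ∏.∑ g
    ∏-scale = ∏.∑-reindex (a *_) (a⁻¹ *_) (b*[c*x]≡x a a⁻¹ aa⁻¹≡1) (b*[c*x]≡x a⁻¹ a a⁻¹a≡1)

  units : ℕ
  units = count (λ x → ¬? (x ≟ 0#))

  1+units≡q : suc units ≡ q
  1+units≡q = trans (cong (N._+ units) (sym (count-≡ 0#))) (count-compl (_≟ 0#))

  ∏-when-const : ∀ a → ∏.∑ (λ x → ∏.when (¬? (x ≟ 0#)) a) ≡ a ^ units
  ∏-when-const a = trans (∏.∑-when-const (λ x → ¬? (x ≟ 0#)) a) (sym (^≡^ₛ a units))

  zeroToOne : Carrier → Carrier
  zeroToOne x = ∏.when (¬? (x ≟ 0#)) x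

  zeroToOne≢0 : ∀ x → zeroToOne x ≢ 0#
  zeroToOne≢0 x with x ≟ 0#
  ... | yes _ = 1≢0
  ... | no x≢0 = x≢0

  zeroToOne-scale : ∀ {a} → a ≢ 0# → ∀ x → zeroToOne (a * x) ≡ ∏.when (¬? (x ≟ 0#)) a * zeroToOne x
  zeroToOne-scale {a} a≢0 x with x ≟ 0# | (a * x) ≟ 0#
  ... | yes _ | yes _ = sym (*-identityˡ 1#)
  ... | yes x≡0 | no ax≢0 = contradiction (trans (cong (a *_) x≡0) (zeroʳ a)) ax≢0
  ... | no x≢0 | yes ax≡0 = contradiction (x≢0⇒x*y≡0⇒y≡0 a≢0 ax≡0) x≢0
  ... | no _ | no _ = refl

  fermat-units : ∀ {a} → a ≢ 0# → a ^ units ≡ 1#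
  fermat-units {a} a≢0 with x*y≡y⇒x≡1⊎y≡0 aᵘP≡P
    where
    P = ∏.∑ zeroToOne
    aᵘP≡P : a ^ units * P ≡ P
    aᵘP≡P = begin
      a ^ units * P                                         ≡⟨ cong (_* P) (sym (∏-when-const a)) ⟩
      ∏.∑ (λ x → ∏.when (¬? (x ≟ 0#)) a) * P                ≡⟨ sym (∏.∑-distrib (λ x → ∏.when (¬? (x ≟ 0#)) a) zeroToOne) ⟩
      ∏.∑ (λ x → ∏.when (¬? (x ≟ 0#)) a * zeroToOne x)      ≡⟨ ∏.∑-cong (sym ∘ zeroToOne-scale a≢0) ⟩
      ∏.∑ (λ x → zeroToOne (a * x))                         ≡⟨ ∏-scale a≢0 zeroToOne ⟩
      P                                                     ∎
  ... | inj₁ aᵘ≡1 = aᵘ≡1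
  ... | inj₂ P≡0 = contradiction P≡0 (∏.∑-preserves (_≢ 0#) 1≢0 *-nonzero zeroToOne≢0)
    where
    *-nonzero : ∀ {x y} → x ≢ 0# → y ≢ 0# → x * y ≢ 0#
    *-nonzero x≢0 y≢0 xy≡0 = y≢0 (x≢0⇒x*y≡0⇒y≡0 x≢0 xy≡0)

  fermat : ∀ x → x ^ q ≡ x
  fermat x with x ≟ 0#
  ... | yes refl = subst (λ n → 0# ^ n ≡ 0#) 1+units≡q (zeroˡ _)
  ... | no x≢0 = subst (λ n → x ^ n ≡ x) 1+units≡q (trans (cong (x *_) (fermat-units x≢0)) (*-identityʳ x))

  ∑-pow≡0 : ∀ m {a} → a ≢ 0# → a ^ m ≢ 1# → ∑ (λ x → x ^ m) ≡ 0#
  ∑-pow≡0 m {a} a≢0 aᵐ≢1 with x*y≡y⇒x≡1⊎y≡0 aᵐS≡S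
    where
    aᵐS≡S : a ^ m * ∑ (λ x → x ^ m) ≡ ∑ (λ x → x ^ m)
    aᵐS≡S = begin
      a ^ m * ∑ (λ x → x ^ m)    ≡⟨ *-∑ (a ^ m) (_^ m) ⟩
      ∑ (λ x → a ^ m * x ^ m)    ≡⟨ ∑-cong (λ x → sym (*-^ a x m)) ⟩
      ∑ (λ x → (a * x) ^ m)      ≡⟨ ∑-scale a≢0 (_^ m) ⟩
      ∑ (λ x → x ^ m)            ∎
  ... | inj₁ aᵐ≡1 = contradiction aᵐ≡1 aᵐ≢1
  ... | inj₂ S≡0 = S≡0

  ∑-pow-units : ∑ (λ x → x ^ units) ≡ - 1#
  ∑-pow-units = begin
    ∑ (λ x → x ^ units)                     ≡⟨ ∑-cong xᵘ≡indicator ⟩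
    ∑ (λ x → when (¬? (x ≟ 0#)) 1#)         ≡⟨ ∑-when-const (λ x → ¬? (x ≟ 0#)) 1# ⟩
    units · 1#                              ≡⟨ inverseʳ-unique 1# (units · 1#) (subst (λ n → n · 1# ≡ 0#) (sym 1+units≡q) characteristic) ⟩
    - 1#                                    ∎
    where
    units≢0 : units ≢ 0
    units≢0 units≡0 = 1≢0 (trans (sym (+-identityʳ 1#)) (trans (cong (_· 1#) (trans (cong suc (sym units≡0)) 1+units≡q)) characteristic))
    xᵘ≡indicator : ∀ x → x ^ units ≡ when (¬? (x ≟ 0#)) 1#
    xᵘ≡indicator x with x ≟ 0#
    ... | no x≢0 = fermat-units x≢0
    ... | yes refl with units | units≢0
    ...   | zero | units≢0 = contradiction refl units≢0
    ...   | suc n | _ = zeroˡ _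

  -- horner lc (c₀ ∷ … ∷ cₙ₋₁) x = c₀ + c₁x + … + cₙ₋₁xⁿ⁻¹ + lc·xⁿ, of degree n when lc ≢ 0#.
  horner : Carrier → List Carrier → Carrier → Carrier
  horner lc [] x = lc
  horner lc (c ∷ cs) x = c + x * horner lc cs x

  quotient : Carrier → Carrier → List Carrier → List Carrier
  quotient a lc [] = []
  quotient a lc (d ∷ ds) = horner lc (d ∷ ds) a ∷ quotient a lc ds

  length-quotient : ∀ a lc cs → length (quotient a lc cs) ≡ length cs
  length-quotient a lc [] = refl
  length-quotient a lc (d ∷ ds) = cong suc (length-quotient a lc ds)

  horner-shift : ∀ a t lc c cs →
                 horner lc (c ∷ cs) (a + t) ≡ horner lc (c ∷ cs) a + t * horner lc (quotient a lc cs) (a + t)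
  horner-shift a t lc c [] = solve 4 (λ a t lc c → c :+ (a :+ t) :* lc := (c :+ a :* lc) :+ t :* lc) refl a t lc c
  horner-shift a t lc c (d ∷ ds) = trans (cong (λ z → c + (a + t) * z) (horner-shift a t lc d ds))
    (solve 5 (λ a t c E Q → c :+ (a :+ t) :* (E :+ t :* Q) := (c :+ a :* E) :+ t :* (E :+ (a :+ t) :* Q)) refl
           a t c (horner lc (d ∷ ds) a) (horner lc (quotient a lc ds) (a + t)))

  horner-factor : ∀ a lc c cs x →
                  horner lc (c ∷ cs) x ≡ horner lc (c ∷ cs) a + (x - a) * horner lc (quotient a lc cs) x
  horner-factor a lc c cs x = subst (λ y → horner lc (c ∷ cs) y ≡ horner lc (c ∷ cs) a + (x - a) * horner lc (quotient a lc cs) y)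
                                    a+[x-a]≡x (horner-shift a (x - a) lc c cs)
    where
    a+[x-a]≡x : a + (x - a) ≡ x
    a+[x-a]≡x = trans (+-comm a (x - a)) (trans (+-assoc x (- a) a) (trans (cong (x +_) (-‿inverseˡ a)) (+-identityʳ x)))

  horner-root-split : ∀ {a lc c cs x} → horner lc (c ∷ cs) a ≡ 0# → horner lc (c ∷ cs) x ≡ 0# →
                      x ≡ a ⊎ horner lc (quotient a lc cs) x ≡ 0#
  horner-root-split {a} {lc} {c} {cs} {x} root fx≡0 with x*y≡0⇒x≡0⊎y≡0 (begin
    (x - a) * g x                               ≡⟨ sym (+-identityˡ _) ⟩
    0# + (x - a) * g x                          ≡⟨ cong (_+ (x - a) * g x) (sym root) ⟩
    horner lc (c ∷ cs) a + (x - a) * g x        ≡⟨ sym (horner-factor a lc c cs x) ⟩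
    horner lc (c ∷ cs) x                        ≡⟨ fx≡0 ⟩
    0#                                          ∎)
    where
    g = horner lc (quotient a lc cs)
  ... | inj₁ x-a≡0 = inj₁ (x-y≡0⇒x≡y x-a≡0)
  ... | inj₂ gx≡0 = inj₂ gx≡0

  roots-bound : ∀ {lc} → lc ≢ 0# → ∀ cs → count (λ x → horner lc cs x ≟ 0#) ≤ length cs
  roots-bound {lc} lc≢0 cs = bound (length cs) cs refl
    where
    bound : ∀ n cs → length cs ≡ n → count (λ x → horner lc cs x ≟ 0#) ≤ n
    bound zero [] _ = NP.≤-reflexive (count-⊥ (λ x → horner lc [] x ≟ 0#) (λ _ → lc≢0))
    bound (suc n) (c ∷ cs) length≡ with ∃? (λ x → horner lc (c ∷ cs) x ≟ 0#)
    ... | no noRoot = subst (_≤ suc n) (sym (count-⊥ (λ x → horner lc (c ∷ cs) x ≟ 0#) (λ x root → noRoot (x , root)))) z≤n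
    ... | yes (a , root) =
      NP.≤-trans (count-∪ (λ x → horner lc (c ∷ cs) x ≟ 0#) (_≟ a) (λ x → horner lc g x ≟ 0#)
                          (horner-root-split {a} {lc} {c} {cs} root))
                 (NP.+-mono-≤ (NP.≤-reflexive (count-≡ a))
                              (bound n g (trans (length-quotient a lc cs) (NP.suc-injective length≡))))
      where
      g = quotient a lc cs

  horner-zeros : ∀ n x → horner 1# (replicate n 0#) x ≡ x ^ n
  horner-zeros zero x = refl
  horner-zeros (suc n) x = trans (+-identityˡ _) (cong (x *_) (horner-zeros n x))

  ∃-pow≢1 : ∀ m → 1 ≤ m → suc m < q → Σ Carrier λ a → a ≢ 0# × a ^ m ≢ 1#
  ∃-pow≢1 (suc m) _ 1+m<q with count<size⇒∃¬ (λ x → horner 1# cs x ≟ 0#)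
                                 (NP.≤-<-trans (roots-bound 1≢0 cs) (subst (_< q) (sym length-cs) 1+m<q))
    where
    -- the coefficients of x(x¹⁺ᵐ - 1), a polynomial of degree 2 + m < q
    cs = 0# ∷ - 1# ∷ replicate m 0#
    length-cs : length cs ≡ suc (suc m)
    length-cs = cong (λ n → suc (suc n)) (length-replicate m)
  ... | a , a≢root = a , a≢0 , aᵐ≢1
    where
    value : horner 1# (0# ∷ - 1# ∷ replicate m 0#) a ≡ a * (- 1# + a ^ suc m)
    value = trans (+-identityˡ _) (cong (λ z → a * (- 1# + a * z)) (horner-zeros m a))
    a≢0 : a ≢ 0#
    a≢0 a≡0 = a≢root (trans value (trans (cong (_* (- 1# + a ^ suc m)) a≡0) (zeroˡ _)))
    aᵐ≢1 : a ^ suc m ≢ 1#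
    aᵐ≢1 aᵐ≡1 = a≢root (trans value (trans (cong (λ z → a * (- 1# + z)) aᵐ≡1) (trans (cong (a *_) (-‿inverseˡ 1#)) (zeroʳ a))))

  ∑-pow-small : ∀ m → 1 ≤ m → suc m < q → ∑ (λ x → x ^ m) ≡ 0#
  ∑-pow-small m 1≤m 1+m<q with ∃-pow≢1 m 1≤m 1+m<q
  ... | a , a≢0 , aᵐ≢1 = ∑-pow≡0 m a≢0 aᵐ≢1

  eval : List Carrier → Carrier → Carrier
  eval [] x = 0#
  eval (c ∷ cs) x = c + x * eval cs x

  horner≡eval : ∀ lc cs x → horner lc cs x ≡ eval (cs ++ lc ∷ []) x
  horner≡eval lc [] x = solve 2 (λ lc x → lc := lc :+ x :* con 0) refl lc x
  horner≡eval lc (c ∷ cs) x = cong (λ z → c + x * z) (horner≡eval lc cs x)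

  horner-pad : ∀ lc N ds → length ds ≤ N →
               Σ (List Carrier) λ cs → length cs ≡ N × (∀ x → horner lc cs x ≡ eval ds x + lc * x ^ N)
  horner-pad lc zero [] z≤n = [] , refl , λ x → solve 1 (λ lc → lc := con 0 :+ lc :* con 1) refl lc
  horner-pad lc (suc N) [] z≤n with horner-pad lc N [] z≤n
  ... | cs , length-cs , value = 0# ∷ cs , cong suc length-cs , λ x → trans (cong (λ z → 0# + x * z) (value x))
          (solve 3 (λ x lc P → con 0 :+ x :* (con 0 :+ lc :* P) := con 0 :+ lc :* (x :* P)) refl x lc (x ^ N))
  horner-pad lc (suc N) (d ∷ ds) (s≤s len≤N) with horner-pad lc N ds len≤N
  ... | cs , length-cs , value = d ∷ cs , cong suc length-cs , λ x → trans (cong (λ z → d + x * z) (value x))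
          (solve 5 (λ d x E lc P → d :+ x :* (E :+ lc :* P) := (d :+ x :* E) :+ lc :* (x :* P)) refl d x (eval ds x) lc (x ^ N))

  trace-eval : ∀ j → Σ (List Carrier) λ ds → length ds ≤ 3 N.^ j × (∀ x → trace j x ≡ eval ds x)
  trace-eval zero = [] , z≤n , λ x → refl
  trace-eval (suc j) with trace-eval j
  ... | ds , length-ds , value with horner-pad 1# (3 N.^ j) ds length-ds
  ...   | cs , length-cs , value' = cs ++ 1# ∷ [] , length≤ , λ x → begin
    trace j x + x ^ (3 N.^ j)             ≡⟨ cong₂ _+_ (value x) (sym (*-identityˡ _)) ⟩
    eval ds x + 1# * x ^ (3 N.^ j)        ≡⟨ sym (value' x) ⟩
    horner 1# cs x                        ≡⟨ horner≡eval 1# cs x ⟩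
    eval (cs ++ 1# ∷ []) x                ∎
    where
    length≤ : length (cs ++ 1# ∷ []) ≤ 3 N.^ suc j
    length≤ = subst (_≤ 3 N.^ suc j) (sym (trans (length-++ cs) (cong (N._+ 1) length-cs)))
                (NP.+-monoʳ-≤ (3 N.^ j) (NP.≤-trans (NP.m^n>0 3 j) (NP.m≤m+n (3 N.^ j) _)))

  trace-kernel-bound : ∀ j → count (λ x → trace (suc j) x ≟ 0#) ≤ 3 N.^ j
  trace-kernel-bound j with trace-eval j
  ... | ds , length-ds , value with horner-pad 1# (3 N.^ j) ds length-ds
  ...   | cs , length-cs , value' = subst (_≤ 3 N.^ j) same-count (subst (count (λ x → horner 1# cs x ≟ 0#) ≤_) length-cs (roots-bound 1≢0 cs))
    where
    same-count : count (λ x → horner 1# cs x ≟ 0#) ≡ count (λ x → trace (suc j) x ≟ 0#)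
    same-count = count-⇔ (λ x → horner 1# cs x ≟ 0#) (λ x → trace (suc j) x ≟ 0#)
                         (λ x → mk⇔ (trans (sym (horner≡trace x))) (trans (horner≡trace x)))
      where
      horner≡trace : ∀ x → horner 1# cs x ≡ trace (suc j) x
      horner≡trace x = trans (value' x) (cong₂ _+_ (sym (value x)) (*-identityˡ _))

module CharacteristicThree {q : ℕ} (F : FiniteField q)
  (char3 : FieldTheory._·_ F 3 (FiniteField.1# F) ≡ FiniteField.0# F) where

  open FiniteField F
  open FieldTheory F

  open ≡.≡-Reasoning

  -- A ring solver whose coefficients are natural numbers read modulo 3, sound since 3 · 1# ≡ 0#.
  private
    open RingProperties (CommutativeRing.ring ring) using (-1*x≈-x)
    open SemiringMultTC semiring using () renaming (_×_ to _·ₜ_; ×1-homo-* to ×1-homo-*ₜ)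
    open MonoidMultTC (CommutativeMonoid.monoid +-commutativeMonoid) using (×ᵤ≈×) renaming (×-homo-+ to ×-homo-+ₜ)

    char3ₜ : 3 ·ₜ 1# ≡ 0#
    char3ₜ = trans (sym (×ᵤ≈× 3 1#)) char3

    2·1≡-1 : 2 ·ₜ 1# ≡ - 1#
    2·1≡-1 = inverseʳ-unique 1# (2 ·ₜ 1#) (trans (sym (+-assoc 1# 1# 1#)) char3ₜ)

    ·-mod3 : ∀ m → m ·ₜ 1# ≡ (m % 3) ·ₜ 1#
    ·-mod3 m = begin
      m ·ₜ 1#                                      ≡⟨ cong (_·ₜ 1#) (m≡m%n+[m/n]*n m 3) ⟩
      (m % 3 N.+ (m / 3) N.* 3) ·ₜ 1#              ≡⟨ ×-homo-+ₜ 1# (m % 3) _ ⟩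
      (m % 3) ·ₜ 1# + ((m / 3) N.* 3) ·ₜ 1#        ≡⟨ cong ((m % 3) ·ₜ 1# +_) (×1-homo-*ₜ (m / 3) 3) ⟩
      (m % 3) ·ₜ 1# + (m / 3) ·ₜ 1# * 3 ·ₜ 1#      ≡⟨ cong (λ z → (m % 3) ·ₜ 1# + (m / 3) ·ₜ 1# * z) char3ₜ ⟩
      (m % 3) ·ₜ 1# + (m / 3) ·ₜ 1# * 0#           ≡⟨ cong ((m % 3) ·ₜ 1# +_) (zeroʳ _) ⟩
      (m % 3) ·ₜ 1# + 0#                           ≡⟨ +-identityʳ _ ⟩
      (m % 3) ·ₜ 1#                                ∎

    ℕmod3 : RawRing _ _
    ℕmod3 = record
      { Carrier = ℕ ; _≈_ = _≡_
      ; _+_ = λ m n → (m N.+ n) % 3 ; _*_ = λ m n → (m N.* n) % 3 ; -_ = λ n → (2 N.* n) % 3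
      ; 0# = 0 ; 1# = 1 }

    ℕmod3⟶F : ℕmod3 ACR.-Raw-AlmostCommutative⟶ ACR.fromCommutativeRing ring
    ℕmod3⟶F = record
      { ⟦_⟧ = λ n → n ·ₜ 1#
      ; +-homo = λ m n → trans (sym (·-mod3 (m N.+ n))) (×-homo-+ₜ 1# m n)
      ; *-homo = λ m n → trans (sym (·-mod3 (m N.* n))) (×1-homo-*ₜ m n)
      ; -‿homo = λ n → trans (sym (·-mod3 (2 N.* n)))
                       (trans (×1-homo-*ₜ 2 n) (trans (cong (_* (n ·ₜ 1#)) 2·1≡-1) (-1*x≈-x (n ·ₜ 1#))))
      ; 0-homo = refl
      ; 1-homo = refl
      }

    ℕmod3-≟ : ∀ m n → Maybe (m ·ₜ 1# ≡ n ·ₜ 1#)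
    ℕmod3-≟ m n with m % 3 N.≟ n % 3
    ... | yes e = just (trans (·-mod3 m) (trans (cong (_·ₜ 1#) e) (sym (·-mod3 n))))
    ... | no _ = nothing

  open RingSolver ℕmod3 (ACR.fromCommutativeRing ring) ℕmod3⟶F ℕmod3-≟ public
    using (solve; _:=_; _:+_; _:*_; _:-_; :-_; _:^_; con)

  frobenius : ∀ x y → (x - y) ^ 3 ≡ x ^ 3 - y ^ 3
  frobenius = solve 2 (λ x y → (x :- y) :^ 3 := x :^ 3 :- y :^ 3) refl

  frobenius-iterate : ∀ i x y → (x - y) ^ (3 N.^ i) ≡ x ^ (3 N.^ i) - y ^ (3 N.^ i)
  frobenius-iterate zero x y = solve 2 (λ x y → (x :- y) :^ 1 := x :^ 1 :- y :^ 1) refl x y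
  frobenius-iterate (suc i) x y = begin
    (x - y) ^ (3 N.^ suc i)                  ≡⟨ ^3^suc (x - y) ⟩
    ((x - y) ^ (3 N.^ i)) ^ 3                ≡⟨ cong (_^ 3) (frobenius-iterate i x y) ⟩
    (x ^ (3 N.^ i) - y ^ (3 N.^ i)) ^ 3      ≡⟨ frobenius _ _ ⟩
    (x ^ (3 N.^ i)) ^ 3 - (y ^ (3 N.^ i)) ^ 3 ≡⟨ sym (cong₂ _-_ (^3^suc x) (^3^suc y)) ⟩
    x ^ (3 N.^ suc i) - y ^ (3 N.^ suc i)    ∎
    where
    ^3^suc : ∀ z → z ^ (3 N.^ suc i) ≡ (z ^ (3 N.^ i)) ^ 3
    ^3^suc z = trans (cong (z ^_) (NP.*-comm 3 (3 N.^ i))) (sym (^-* z (3 N.^ i) 3))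

  ℘ : Carrier → Carrier
  ℘ x = x ^ 3 - x

  trace-℘ : ∀ i x → trace i (℘ x) ≡ x ^ (3 N.^ i) - x
  trace-℘ zero x = solve 1 (λ x → con 0 := x :^ 1 :- x) refl x
  trace-℘ (suc i) x = begin
    trace i (℘ x) + ℘ x ^ (3 N.^ i)                         ≡⟨ cong₂ _+_ (trace-℘ i x) (frobenius-iterate i (x ^ 3) x) ⟩
    (x ^ (3 N.^ i) - x) + ((x ^ 3) ^ (3 N.^ i) - x ^ (3 N.^ i)) ≡⟨ cong (λ z → (x ^ (3 N.^ i) - x) + (z - x ^ (3 N.^ i))) (^-* x 3 (3 N.^ i)) ⟩
    (x ^ (3 N.^ i) - x) + (x ^ (3 N.^ suc i) - x ^ (3 N.^ i)) ≡⟨ solve 3 (λ A B x → (A :- x) :+ (B :- A) := B :- x) refl _ _ x ⟩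
    x ^ (3 N.^ suc i) - x                                     ∎

  ℘0≡0 : ℘ 0# ≡ 0#
  ℘0≡0 = solve 0 (con 0 :^ 3 :- con 0 := con 0) refl

  ℘1≡0 : ℘ 1# ≡ 0#
  ℘1≡0 = solve 0 (con 1 :^ 3 :- con 1 := con 0) refl

  ℘-1≡0 : ℘ (- 1#) ≡ 0#
  ℘-1≡0 = solve 0 ((:- con 1) :^ 3 :- (:- con 1) := con 0) refl

  ℘-neg : ∀ x → ℘ (- x) ≡ - ℘ x
  ℘-neg = solve 1 (λ x → (:- x) :^ 3 :- (:- x) := :- (x :^ 3 :- x)) refl

  ℘-sub : ∀ x y → ℘ (x - y) ≡ ℘ x - ℘ y
  ℘-sub = solve 2 (λ x y → (x :- y) :^ 3 :- (x :- y) := (x :^ 3 :- x) :- (y :^ 3 :- y)) refl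

  ℘[d+1]≡℘d : ∀ d → ℘ (d + 1#) ≡ ℘ d
  ℘[d+1]≡℘d = solve 1 (λ d → (d :+ con 1) :^ 3 :- (d :+ con 1) := d :^ 3 :- d) refl

  ℘[d-1]≡℘d : ∀ d → ℘ (d - 1#) ≡ ℘ d
  ℘[d-1]≡℘d = solve 1 (λ d → (d :- con 1) :^ 3 :- (d :- con 1) := d :^ 3 :- d) refl

  ℘-kernel : ∀ {z} → ℘ z ≡ 0# → z ≡ 0# ⊎ z ≡ 1# ⊎ z ≡ - 1#
  ℘-kernel {z} ℘z≡0 = Sum.map₂ (Sum.map x-y≡0⇒x≡y x+y≡0⇒x≡-y ∘ x*y≡0⇒x≡0⊎y≡0) (x*y≡0⇒x≡0⊎y≡0 z[z-1][z+1]≡0)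
    where
    z[z-1][z+1]≡0 : z * ((z - 1#) * (z + 1#)) ≡ 0#
    z[z-1][z+1]≡0 = trans (solve 1 (λ z → z :* ((z :- con 1) :* (z :+ con 1)) := z :^ 3 :- z) refl z) ℘z≡0

  ℘-fibre : ∀ {x d} → ℘ x ≡ ℘ d → x ≡ d ⊎ x ≡ d + 1# ⊎ x ≡ d - 1#
  ℘-fibre {x} {d} ℘x≡℘d = Sum.map x-y≡0⇒x≡y (Sum.map shift shift) (℘-kernel ℘[x-d]≡0)
    where
    ℘[x-d]≡0 : ℘ (x - d) ≡ 0#
    ℘[x-d]≡0 = trans (℘-sub x d) (x≡y⇒x-y≡0 ℘x≡℘d)
    shift : ∀ {c} → x - d ≡ c → x ≡ d + c
    shift x-d≡c = trans (solve 2 (λ x d → x := d :+ (x :- d)) refl x d) (cong (d +_) x-d≡c)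

  d≢d+1 : ∀ d → d ≢ d + 1#
  d≢d+1 d = x-y≡z≢0⇒x≢y (solve 1 (λ d → d :- (d :+ con 1) := :- con 1) refl d) (λ -1≡0 → 1≢0 (-x≡0⇒x≡0 -1≡0))

  d≢d-1 : ∀ d → d ≢ d - 1#
  d≢d-1 d = x-y≡z≢0⇒x≢y (solve 1 (λ d → d :- (d :- con 1) := con 1) refl d) 1≢0

  d+1≢d-1 : ∀ d → d + 1# ≢ d - 1#
  d+1≢d-1 d = x-y≡z≢0⇒x≢y (solve 1 (λ d → (d :+ con 1) :- (d :- con 1) := :- con 1) refl d) (λ -1≡0 → 1≢0 (-x≡0⇒x≡0 -1≡0))

  r₁ r₂ r₃ : Carrier → Carrier
  r₁ d = d * d - d
  r₂ d = d * d + d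
  r₃ d = d * d - 1#

  h-factor : ∀ x d → h x - ℘ d * ℘ d ≡ (x - r₁ d) * ((x - r₂ d) * (x - r₃ d))
  h-factor = solve 2 (λ x d → (x :^ 3 :+ x :^ 2) :- (d :^ 3 :- d) :* (d :^ 3 :- d)
                          := (x :- (d :* d :- d)) :* ((x :- (d :* d :+ d)) :* (x :- (d :* d :- con 1)))) refl

  h≡℘²⇔ : ∀ x d → h x ≡ ℘ d * ℘ d ⇔ (x ≡ r₁ d ⊎ x ≡ r₂ d ⊎ x ≡ r₃ d)
  h≡℘²⇔ x d = mk⇔ to from
    where
    to : h x ≡ ℘ d * ℘ d → x ≡ r₁ d ⊎ x ≡ r₂ d ⊎ x ≡ r₃ d
    to hx≡℘² = Sum.map x-y≡0⇒x≡y (Sum.map x-y≡0⇒x≡y x-y≡0⇒x≡y ∘ x*y≡0⇒x≡0⊎y≡0)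
                       (x*y≡0⇒x≡0⊎y≡0 (trans (sym (h-factor x d)) (x≡y⇒x-y≡0 hx≡℘²)))
    vanish : (x - r₁ d) * ((x - r₂ d) * (x - r₃ d)) ≡ 0# → h x ≡ ℘ d * ℘ d
    vanish product≡0 = x-y≡0⇒x≡y (trans (h-factor x d) product≡0)
    from : x ≡ r₁ d ⊎ x ≡ r₂ d ⊎ x ≡ r₃ d → h x ≡ ℘ d * ℘ d
    from (inj₁ refl) = vanish (trans (cong (_* ((x - r₂ d) * (x - r₃ d))) (-‿inverseʳ x)) (zeroˡ _))
    from (inj₂ (inj₁ refl)) =
      vanish (trans (cong ((x - r₁ d) *_) (trans (cong (_* (x - r₃ d)) (-‿inverseʳ x)) (zeroˡ _))) (zeroʳ _))
    from (inj₂ (inj₂ refl)) =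
      vanish (trans (cong ((x - r₁ d) *_) (trans (cong ((x - r₂ d) *_) (-‿inverseʳ x)) (zeroʳ _))) (zeroʳ _))

  h≡0⇔ : ∀ x → h x ≡ 0# ⇔ (x ≡ 0# ⊎ x ≡ - 1#)
  h≡0⇔ x = mk⇔ to from
    where
    to : h x ≡ 0# → x ≡ 0# ⊎ x ≡ - 1#
    to hx≡0 = [ inj₁ , [ inj₁ , inj₂ ∘ x+y≡0⇒x≡-y ] ∘ x*y≡0⇒x≡0⊎y≡0 ] (x*y≡0⇒x≡0⊎y≡0 x[x[x+1]]≡0)
      where
      x[x[x+1]]≡0 : x * (x * (x + 1#)) ≡ 0#
      x[x[x+1]]≡0 = trans (solve 1 (λ x → x :* (x :* (x :+ con 1)) := x :^ 3 :+ x :^ 2) refl x) hx≡0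
    from : x ≡ 0# ⊎ x ≡ - 1# → h x ≡ 0#
    from (inj₁ refl) = solve 0 (con 0 :^ 3 :+ con 0 :^ 2 := con 0) refl
    from (inj₂ refl) = solve 0 ((:- con 1) :^ 3 :+ (:- con 1) :^ 2 := con 0) refl

  ℘≢0⇒r-distinct : ∀ {d} → ℘ d ≢ 0# → r₁ d ≢ r₂ d × r₁ d ≢ r₃ d × r₂ d ≢ r₃ d
  ℘≢0⇒r-distinct {d} ℘d≢0 =
    x-y≡z≢0⇒x≢y (solve 1 (λ d → (d :* d :- d) :- (d :* d :+ d) := d) refl d) (λ { refl → ℘d≢0 ℘0≡0 }) ,
    x-y≡z≢0⇒x≢y (solve 1 (λ d → (d :* d :- d) :- (d :* d :- con 1) := con 1 :- d) refl d)
                (λ 1-d≡0 → ℘d≢0 (subst (λ z → ℘ z ≡ 0#) (x-y≡0⇒x≡y 1-d≡0) ℘1≡0)) ,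
    x-y≡z≢0⇒x≢y (solve 1 (λ d → (d :* d :+ d) :- (d :* d :- con 1) := d :+ con 1) refl d)
                (λ d+1≡0 → ℘d≢0 (subst (λ z → ℘ z ≡ 0#) (sym (x+y≡0⇒x≡-y d+1≡0)) ℘-1≡0))

  h-collision : ∀ {x y} → x ≢ y → h x ≡ h y → h x ≡ ℘ (x - y) * ℘ (x - y)
  h-collision {x} {y} x≢y hx≡hy = Equivalence.from (h≡℘²⇔ x (x - y)) (inj₁ x≡r₁)
    where
    s≡0 : (x - y) * (x - y) + x + y ≡ 0#
    s≡0 = x≢0⇒x*y≡0⇒y≡0 (λ x-y≡0 → x≢y (x-y≡0⇒x≡y x-y≡0))
            (trans (solve 2 (λ x y → (x :- y) :* ((x :- y) :* (x :- y) :+ x :+ y) := (x :^ 3 :+ x :^ 2) :- (y :^ 3 :+ y :^ 2)) refl x y)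
                   (x≡y⇒x-y≡0 hx≡hy))
    x≡r₁ : x ≡ r₁ (x - y)
    x≡r₁ = begin
      x                                                           ≡⟨ solve 2 (λ x y → x := ((x :- y) :* (x :- y) :- (x :- y)) :- ((x :- y) :* (x :- y) :+ x :+ y)) refl x y ⟩
      r₁ (x - y) - ((x - y) * (x - y) + x + y)                     ≡⟨ cong (λ z → r₁ (x - y) - z) s≡0 ⟩
      r₁ (x - y) - 0#                                             ≡⟨ solve 1 (λ a → a :- con 0 := a) refl _ ⟩
      r₁ (x - y)                                                  ∎

  #h⁻¹ : Carrier → ℕ
  #h⁻¹ γ = count (λ x → h x ≟ γ)

  #h⁻¹0≡2 : #h⁻¹ 0# ≡ 2
  #h⁻¹0≡2 = count-pair (λ x → h x ≟ 0#) (λ 0≡-1 → 1≢0 (-x≡0⇒x≡0 (sym 0≡-1))) h≡0⇔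

  #h⁻¹℘²≡3 : ∀ {d} → ℘ d ≢ 0# → #h⁻¹ (℘ d * ℘ d) ≡ 3
  #h⁻¹℘²≡3 {d} ℘d≢0 with ℘≢0⇒r-distinct ℘d≢0
  ... | r₁≢r₂ , r₁≢r₃ , r₂≢r₃ = count-triple (λ x → h x ≟ (℘ d * ℘ d)) r₁≢r₂ r₁≢r₃ r₂≢r₃ (λ x → h≡℘²⇔ x d)

  data Preimages (γ : Carrier) : Set where
    zero-value : γ ≡ 0# → #h⁻¹ γ ≡ 2 → Preimages γ
    ℘²-value : ∀ d → ℘ d ≢ 0# → γ ≡ ℘ d * ℘ d → #h⁻¹ γ ≡ 3 → Preimages γ
    other-value : γ ≢ 0# → #h⁻¹ γ ≤ 1 → Preimages γ

  classify : ∀ γ → Preimages γ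
  classify γ with γ ≟ 0#
  ... | yes refl = zero-value refl #h⁻¹0≡2
  ... | no γ≢0 with 1 N.<? #h⁻¹ γ
  ...   | no ¬1<# = other-value γ≢0 (NP.≮⇒≥ ¬1<#)
  ...   | yes 1<# with 1<count⇒distinct (λ x → h x ≟ γ) 1<#
  ...     | x , y , x≢y , hx≡γ , hy≡γ = ℘²-value d ℘d≢0 γ≡℘² (trans (cong #h⁻¹ γ≡℘²) (#h⁻¹℘²≡3 ℘d≢0))
    where
    d = x - y
    γ≡℘² : γ ≡ ℘ d * ℘ d
    γ≡℘² = trans (sym hx≡γ) (h-collision x≢y (trans hx≡γ (sym hy≡γ)))
    ℘d≢0 : ℘ d ≢ 0#
    ℘d≢0 ℘d≡0 = γ≢0 (trans γ≡℘² (trans (cong (_* ℘ d) ℘d≡0) (zeroˡ (℘ d))))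

  ℘-fibre⇔ : ∀ x d → ℘ x ≡ ℘ d ⇔ (x ≡ d ⊎ x ≡ d + 1# ⊎ x ≡ d - 1#)
  ℘-fibre⇔ x d = mk⇔ ℘-fibre λ where
    (inj₁ refl) → refl
    (inj₂ (inj₁ refl)) → ℘[d+1]≡℘d d
    (inj₂ (inj₂ refl)) → ℘[d-1]≡℘d d

  #℘⁻¹℘≡3 : ∀ d → count (λ x → ℘ x ≟ ℘ d) ≡ 3
  #℘⁻¹℘≡3 d = count-triple (λ x → ℘ x ≟ ℘ d) (d≢d+1 d) (d≢d-1 d) (d+1≢d-1 d) (λ x → ℘-fibre⇔ x d)

  ∑-℘-fibre : ∀ d (v : Carrier → Carrier) →
              ∑ (λ x → when (℘ x ≟ ℘ d) (v x)) ≡ v d + (v (d + 1#) + v (d - 1#))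
  ∑-℘-fibre d v = begin
    ∑ (λ x → when (℘ x ≟ ℘ d) (v x))                                  ≡⟨ ∑-when-⇔ (λ x → ℘ x ≟ ℘ d) three? (λ x → ℘-fibre⇔ x d) v ⟩
    ∑ (λ x → when (three? x) (v x))                                   ≡⟨ ∑-when-⊎ (_≟ d) two? d∉two v ⟩
    ∑ (λ x → when (x ≟ d) (v x)) + ∑ (λ x → when (two? x) (v x))      ≡⟨ cong (∑ (λ x → when (x ≟ d) (v x)) +_) (∑-when-⊎ (_≟ (d + 1#)) (_≟ (d - 1#)) d+1≢d-1' v) ⟩
    ∑ (λ x → when (x ≟ d) (v x)) + (∑ (λ x → when (x ≟ (d + 1#)) (v x)) + ∑ (λ x → when (x ≟ (d - 1#)) (v x)))
                                                                      ≡⟨ cong₂ _+_ (∑-when-≡ d v) (cong₂ _+_ (∑-when-≡ (d + 1#) v) (∑-when-≡ (d - 1#) v)) ⟩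
    v d + (v (d + 1#) + v (d - 1#))                                   ∎
    where
    two? = λ x → (x ≟ (d + 1#)) ⊎-dec (x ≟ (d - 1#))
    three? = λ x → (x ≟ d) ⊎-dec two? x
    d∉two : ∀ x → ¬ (x ≡ d × (x ≡ d + 1# ⊎ x ≡ d - 1#))
    d∉two x (refl , inj₁ x≡d+1) = d≢d+1 d x≡d+1
    d∉two x (refl , inj₂ x≡d-1) = d≢d-1 d x≡d-1
    d+1≢d-1' : ∀ x → ¬ (x ≡ d + 1# × x ≡ d - 1#)
    d+1≢d-1' x (refl , x≡d-1) = d+1≢d-1 d x≡d-1

27≤3^[1+j] : ∀ j → 2 < suc j → 27 ≤ 3 N.^ suc j
27≤3^[1+j] zero (s≤s ())
27≤3^[1+j] (suc zero) (s≤s (s≤s ()))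
27≤3^[1+j] (suc (suc j)) _ = NP.*-monoʳ-≤ 3 (NP.*-monoʳ-≤ 3 (NP.*-monoʳ-≤ 3 (NP.m^n>0 3 j)))

3^[1+j]∈3,9 : ∀ j → suc j ≤ 2 → 3 N.^ suc j ≡ 3 ⊎ 3 N.^ suc j ≡ 9
3^[1+j]∈3,9 zero _ = inj₁ refl
3^[1+j]∈3,9 (suc zero) _ = inj₂ refl
3^[1+j]∈3,9 (suc (suc j)) (s≤s (s≤s ()))

module PowerOfThree (j : ℕ) (F : FiniteField (3 N.^ suc j)) where

  open FiniteField F
  open FieldTheory F

  open ≡.≡-Reasoning

  char3 : 3 · 1# ≡ 0#
  char3 = x^n≡0⇒x≡0 (suc j) (trans (sym (3^i·1≡[3·1]^i (suc j))) characteristic)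
    where
    3^i·1≡[3·1]^i : ∀ i → (3 N.^ i) · 1# ≡ (3 · 1#) ^ i
    3^i·1≡[3·1]^i zero = +-identityʳ 1#
    3^i·1≡[3·1]^i (suc i) = trans (×1-homo-* 3 (3 N.^ i)) (cong ((3 · 1#) *_) (3^i·1≡[3·1]^i i))

  open CharacteristicThree F char3 public

  trace-℘≡0 : ∀ d → trace (suc j) (℘ d) ≡ 0#
  trace-℘≡0 d = trans (trace-℘ (suc j) d) (x≡y⇒x-y≡0 (fermat d))

  Image : Carrier → Set
  Image δ = ∃ λ d → ℘ d ≡ δ

  image? : ∀ δ → Dec (Image δ)
  image? δ = ∃? (λ d → ℘ d ≟ δ)

  #℘⁻¹≡3·𝟙 : ∀ δ → count (λ d → ℘ d ≟ δ) ≡ 3 N.* 𝟙 (image? δ)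
  #℘⁻¹≡3·𝟙 δ with image? δ
  ... | yes (d , refl) = #℘⁻¹℘≡3 d
  ... | no ¬image = count-⊥ (λ d → ℘ d ≟ δ) (λ d ℘d≡δ → ¬image (d , ℘d≡δ))

  |image|≡3^j : count image? ≡ 3 N.^ j
  |image|≡3^j = NP.*-cancelˡ-≡ (count image?) (3 N.^ j) 3 (begin
    3 N.* count image?                       ≡⟨ sym (ℕΣ-*ˡ 3 (λ δ → 𝟙 (image? δ))) ⟩
    ℕΣ.∑ (λ δ → 3 N.* 𝟙 (image? δ))          ≡⟨ ℕΣ.∑-cong (sym ∘ #℘⁻¹≡3·𝟙) ⟩
    ℕΣ.∑ (λ δ → count (λ d → ℘ d ≟ δ))       ≡⟨ fibres-partition ℘ ⟩
    3 N.^ suc j                              ∎)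

  image⇔kernel : ∀ δ → Image δ ⇔ trace (suc j) δ ≡ 0#
  image⇔kernel δ = mk⇔ (λ { (d , refl) → trace-℘≡0 d }) from
    where
    from : trace (suc j) δ ≡ 0# → Image δ
    from trδ≡0 with image? δ
    ... | yes image = image
    ... | no ¬image = contradiction |image|≡3^j (NP.<⇒≢ (NP.≤-trans image+δ≤kernel (trace-kernel-bound j)))
      where
      ⊆kernel : ∀ {x} → Image x ⊎ x ≡ δ → trace (suc j) x ≡ 0#
      ⊆kernel (inj₁ (d , refl)) = trace-℘≡0 d
      ⊆kernel (inj₂ refl) = trδ≡0
      image+δ≡ : count (λ x → image? x ⊎-dec (x ≟ δ)) ≡ suc (count image?)
      image+δ≡ = trans (count-⊎ image? (_≟ δ) (λ { x (image , refl) → ¬image image }))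
                       (trans (cong (count image? N.+_) (count-≡ δ)) (NP.+-comm (count image?) 1))
      image+δ≤kernel : suc (count image?) ≤ count (λ x → trace (suc j) x ≟ 0#)
      image+δ≤kernel = subst (_≤ _) image+δ≡ (count-mono (λ x → image? x ⊎-dec (x ≟ δ)) (λ x → trace (suc j) x ≟ 0#) ⊆kernel)

  -- The preimages of γ beyond the first one; they are also the square roots of γ in the image of ℘.
  surplus : Carrier → ℕ
  surplus γ = 𝟙 (γ ≟ 0#) N.+ 2 N.* 𝟙 (#h⁻¹ γ N.≟ 3)

  value? : ∀ γ → Dec (#h⁻¹ γ ≢ 0)
  value? γ = ¬? (#h⁻¹ γ N.≟ 0)

  ℘²≢0 : ∀ {d} → ℘ d ≢ 0# → ℘ d * ℘ d ≢ 0#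
  ℘²≢0 ℘d≢0 ℘²≡0 = ℘d≢0 (x≢0⇒x*y≡0⇒y≡0 ℘d≢0 ℘²≡0)

  #h⁻¹-split : ∀ γ → #h⁻¹ γ ≡ 𝟙 (value? γ) N.+ surplus γ
  #h⁻¹-split γ = split (#h⁻¹ γ) (γ ≟ 0#) cases
    where
    split : ∀ n {G : Set} (G? : Dec G) → (G × n ≡ 2) ⊎ (¬ G × n ≡ 3) ⊎ (¬ G × n ≤ 1) →
            n ≡ 𝟙 (¬? (n N.≟ 0)) N.+ (𝟙 G? N.+ 2 N.* 𝟙 (n N.≟ 3))
    split _ (yes _) (inj₁ (_ , refl)) = refl
    split _ (no ¬g) (inj₁ (g , _)) = contradiction g ¬g
    split _ (yes g) (inj₂ (inj₁ (¬g , _))) = contradiction g ¬g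
    split _ (no _) (inj₂ (inj₁ (_ , refl))) = refl
    split _ (yes g) (inj₂ (inj₂ (¬g , _))) = contradiction g ¬g
    split zero (no _) (inj₂ (inj₂ _)) = refl
    split (suc zero) (no _) (inj₂ (inj₂ _)) = refl
    split (suc (suc n)) (no _) (inj₂ (inj₂ (_ , s≤s ())))
    cases : (γ ≡ 0# × #h⁻¹ γ ≡ 2) ⊎ (γ ≢ 0# × #h⁻¹ γ ≡ 3) ⊎ (γ ≢ 0# × #h⁻¹ γ ≤ 1)
    cases with classify γ
    ... | zero-value γ≡0 #≡2 = inj₁ (γ≡0 , #≡2)
    ... | ℘²-value d ℘d≢0 refl #≡3 = inj₂ (inj₁ (℘²≢0 ℘d≢0 , #≡3))
    ... | other-value γ≢0 #≤1 = inj₂ (inj₂ (γ≢0 , #≤1))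

  surplus≡ : ∀ {γ} g t → 𝟙 (γ ≟ 0#) ≡ g → 𝟙 (#h⁻¹ γ N.≟ 3) ≡ t → surplus γ ≡ g N.+ 2 N.* t
  surplus≡ g t 𝟙₀≡g 𝟙₃≡t = cong₂ (λ a b → a N.+ 2 N.* b) 𝟙₀≡g 𝟙₃≡t

  image-square-roots : ∀ γ → count (λ x → ((x * x) ≟ γ) ×-dec image? x) ≡ surplus γ
  image-square-roots γ = go (classify γ)
    where
    roots? = λ x → ((x * x) ≟ γ) ×-dec image? x
    go : Preimages γ → count roots? ≡ surplus γ
    go (zero-value γ≡0 #≡2) =
      trans (count-⇔ roots? (_≟ 0#) root⇔) (trans (count-≡ 0#) (sym (surplus≡ 1 0 (𝟙-yes (γ ≟ 0#) γ≡0) (𝟙-no (#h⁻¹ γ N.≟ 3) #≢3))))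
      where
      #≢3 : #h⁻¹ γ ≢ 3
      #≢3 #≡3 = contradiction (trans (sym #≡2) #≡3) λ ()
      root⇔ : ∀ x → (x * x ≡ γ × Image x) ⇔ x ≡ 0#
      root⇔ x = mk⇔ (λ (x²≡γ , _) → [ (λ x≡0 → x≡0) , (λ x≡0 → x≡0) ] (x*y≡0⇒x≡0⊎y≡0 (trans x²≡γ γ≡0)))
                    (λ x≡0 → trans (cong (λ z → z * z) x≡0) (trans (zeroˡ 0#) (sym γ≡0)) , 0# , trans ℘0≡0 (sym x≡0))
    go (℘²-value d ℘d≢0 γ≡℘² #≡3) =
      trans (count-pair roots? a≢-a root⇔) (sym (surplus≡ 0 1 (𝟙-no (γ ≟ 0#) γ≢0) (𝟙-yes (#h⁻¹ γ N.≟ 3) #≡3)))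
      where
      a = ℘ d
      γ≢0 : γ ≢ 0#
      γ≢0 γ≡0 = ℘²≢0 ℘d≢0 (trans (sym γ≡℘²) γ≡0)
      a≢-a : a ≢ - a
      a≢-a = x-y≡z≢0⇒x≢y (solve 1 (λ a → a :- (:- a) := :- a) refl a) (λ -a≡0 → ℘d≢0 (-x≡0⇒x≡0 -a≡0))
      root⇔ : ∀ x → (x * x ≡ γ × Image x) ⇔ (x ≡ a ⊎ x ≡ - a)
      root⇔ x = mk⇔ to from
        where
        to : x * x ≡ γ × Image x → x ≡ a ⊎ x ≡ - a
        to (x²≡γ , _) = Sum.map x-y≡0⇒x≡y x+y≡0⇒x≡-y (x*y≡0⇒x≡0⊎y≡0 [x-a][x+a]≡0)
          where
          [x-a][x+a]≡0 : (x - a) * (x + a) ≡ 0#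
          [x-a][x+a]≡0 = trans (solve 2 (λ x a → (x :- a) :* (x :+ a) := x :* x :- a :* a) refl x a) (x≡y⇒x-y≡0 (trans x²≡γ γ≡℘²))
        from : x ≡ a ⊎ x ≡ - a → x * x ≡ γ × Image x
        from (inj₁ x≡a) = trans (cong (λ z → z * z) x≡a) (sym γ≡℘²) , d , sym x≡a
        from (inj₂ x≡-a) = trans (cong (λ z → z * z) x≡-a) (trans (solve 1 (λ a → (:- a) :* (:- a) := a :* a) refl a) (sym γ≡℘²)) ,
                           - d , trans (℘-neg d) (sym x≡-a)
    go (other-value γ≢0 #≤1) =
      trans (count-⊥ roots? no-root) (sym (surplus≡ 0 0 (𝟙-no (γ ≟ 0#) γ≢0) (𝟙-no (#h⁻¹ γ N.≟ 3) #≢3)))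
      where
      #≢3 : #h⁻¹ γ ≢ 3
      #≢3 #≡3 = contradiction (subst (_≤ 1) #≡3 #≤1) λ { (s≤s ()) }
      no-root : ∀ x → ¬ (x * x ≡ γ × Image x)
      no-root x (x²≡γ , d , ℘d≡x) = #≢3 (subst (λ g → #h⁻¹ g ≡ 3) ℘²≡γ (#h⁻¹℘²≡3 ℘d≢0))
        where
        ℘²≡γ : ℘ d * ℘ d ≡ γ
        ℘²≡γ = trans (cong (λ z → z * z) ℘d≡x) x²≡γ
        ℘d≢0 : ℘ d ≢ 0#
        ℘d≢0 ℘d≡0 = γ≢0 (trans (sym ℘²≡γ) (trans (cong (_* ℘ d) ℘d≡0) (zeroˡ _)))

  3·|values|≡2q : 3 N.* count value? ≡ 2 N.* 3 N.^ suc j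
  3·|values|≡2q = NP.+-cancelʳ-≡ Q (3 N.* V) (2 N.* Q) (begin
    3 N.* V N.+ Q                     ≡⟨ cong (3 N.* V N.+_) Q≡3X ⟩
    3 N.* V N.+ 3 N.* X               ≡⟨ sym (NP.*-distribˡ-+ 3 V X) ⟩
    3 N.* (V N.+ X)                   ≡⟨ cong (3 N.*_) (sym Q≡V+X) ⟩
    3 N.* Q                           ≡⟨ NP.+-comm Q (2 N.* Q) ⟩
    2 N.* Q N.+ Q                     ∎)
    where
    Q = 3 N.^ suc j
    V = count value?
    X = ℕΣ.∑ surplus
    Q≡V+X : Q ≡ V N.+ X
    Q≡V+X = begin
      Q                                        ≡⟨ sym (fibres-partition h) ⟩
      ℕΣ.∑ #h⁻¹                                ≡⟨ ℕΣ.∑-cong #h⁻¹-split ⟩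
      ℕΣ.∑ (λ γ → 𝟙 (value? γ) N.+ surplus γ)  ≡⟨ ℕΣ.∑-distrib (λ γ → 𝟙 (value? γ)) surplus ⟩
      V N.+ X                                  ∎
    Q≡3X : Q ≡ 3 N.* X
    Q≡3X = begin
      Q                                        ≡⟨ cong (3 N.*_) (sym |image|≡3^j) ⟩
      3 N.* count image?                       ≡⟨ cong (3 N.*_) (count-fibres image? (λ x → x * x)) ⟩
      3 N.* ℕΣ.∑ (λ γ → count (λ x → ((x * x) ≟ γ) ×-dec image? x))
                                               ≡⟨ cong (3 N.*_) (ℕΣ.∑-cong image-square-roots) ⟩
      3 N.* X                                  ∎

  𝟙·≡when : ∀ {P : Set} (d : Dec P) x → 𝟙 d · x ≡ when d x
  𝟙·≡when (yes _) x = +-identityʳ x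
  𝟙·≡when (no _) x = refl

  ∑-preimages : ∑ (λ γ → #h⁻¹ γ · γ) ≡ ∑ h
  ∑-preimages = begin
    ∑ (λ γ → #h⁻¹ γ · γ)                            ≡⟨ ∑-cong (λ γ → sym (∑-when-const (λ x → h x ≟ γ) γ)) ⟩
    ∑ (λ γ → ∑ (λ x → when (h x ≟ γ) γ))            ≡⟨ sym (∑-fibres h (λ _ γ → γ)) ⟩
    ∑ h                                             ∎

  ∑-surplus : ∑ (λ γ → surplus γ · γ) ≡ ∑ (λ x → when (image? x) (x * x))
  ∑-surplus = begin
    ∑ (λ γ → surplus γ · γ)                                          ≡⟨ ∑-cong (λ γ → cong (_· γ) (sym (image-square-roots γ))) ⟩
    ∑ (λ γ → count (λ x → ((x * x) ≟ γ) ×-dec image? x) · γ)         ≡⟨ ∑-cong (λ γ → sym (∑-when-const (λ x → ((x * x) ≟ γ) ×-dec image? x) γ)) ⟩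
    ∑ (λ γ → ∑ (λ x → when (((x * x) ≟ γ) ×-dec image? x) γ))         ≡⟨ ∑-cong (λ γ → ∑-cong (λ x → sym (when-when ((x * x) ≟ γ) (image? x) γ))) ⟩
    ∑ (λ γ → ∑ (λ x → when ((x * x) ≟ γ) (when (image? x) γ)))        ≡⟨ sym (∑-fibres (λ x → x * x) (λ x γ → when (image? x) γ)) ⟩
    ∑ (λ x → when (image? x) (x * x))                                ∎

  ∑-image-squares : ∑ (λ x → when (image? x) (x * x)) ≡ ∑ (λ d → - (d * d) * (℘ d * ℘ d))
  ∑-image-squares = sym (begin
    ∑ (λ d → - (d * d) * (℘ d * ℘ d))                                 ≡⟨ ∑-fibres ℘ (λ d δ → - (d * d) * (δ * δ)) ⟩
    ∑ (λ δ → ∑ (λ d → when (℘ d ≟ δ) (- (d * d) * (δ * δ))))           ≡⟨ ∑-cong fibre-weight ⟩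
    ∑ (λ δ → when (image? δ) (δ * δ))                                 ∎)
    where
    fibre-weight : ∀ δ → ∑ (λ d → when (℘ d ≟ δ) (- (d * d) * (δ * δ))) ≡ when (image? δ) (δ * δ)
    fibre-weight δ = go (image? δ)
      where
      go : Dec (Image δ) → ∑ (λ d → when (℘ d ≟ δ) (- (d * d) * (δ * δ))) ≡ when (image? δ) (δ * δ)
      go (yes (d , ℘d≡δ)) = begin
        ∑ (λ x → when (℘ x ≟ δ) (- (x * x) * (δ * δ)))                     ≡⟨ ∑-when-⇔ (λ x → ℘ x ≟ δ) (λ x → ℘ x ≟ ℘ d) fibre⇔ w ⟩
        ∑ (λ x → when (℘ x ≟ ℘ d) (- (x * x) * (δ * δ)))                   ≡⟨ ∑-℘-fibre d w ⟩
        w d + (w (d + 1#) + w (d - 1#))                                   ≡⟨ weights-sum-to-1 d (δ * δ) ⟩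
        δ * δ                                                             ≡⟨ sym (when-yes (image? δ) (d , ℘d≡δ) (δ * δ)) ⟩
        when (image? δ) (δ * δ)                                           ∎
        where
        w = λ x → - (x * x) * (δ * δ)
        fibre⇔ : ∀ x → ℘ x ≡ δ ⇔ ℘ x ≡ ℘ d
        fibre⇔ x = mk⇔ (λ ℘x≡δ → trans ℘x≡δ (sym ℘d≡δ)) (λ ℘x≡℘d → trans ℘x≡℘d ℘d≡δ)
        -- -(d² + (d + 1)² + (d - 1)²) = -(3d² + 2) = 1 in characteristic 3
        weights-sum-to-1 : ∀ d Δ → - (d * d) * Δ + (- ((d + 1#) * (d + 1#)) * Δ + - ((d - 1#) * (d - 1#)) * Δ) ≡ Δ
        weights-sum-to-1 = solve 2 (λ d Δ → :- (d :* d) :* Δ :+ (:- ((d :+ con 1) :* (d :+ con 1)) :* Δ :+ :- ((d :- con 1) :* (d :- con 1)) :* Δ) := Δ) refl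
      go (no ¬image) = trans (∑-when-⊥ (λ d → ℘ d ≟ δ) (λ d → - (d * d) * (δ * δ)) (λ d ℘d≡δ → ¬image (d , ℘d≡δ)))
                             (sym (when-no (image? δ) ¬image (δ * δ)))

  ∑-values : ∑ (λ γ → when (value? γ) γ) ≡ ∑ (λ x → h x + (x * x) * (℘ x * ℘ x))
  ∑-values = begin
    V                                                   ≡⟨ solve 2 (λ V I → V := (V :+ I) :- I) refl V I ⟩
    (V + I) - I                                         ≡⟨ cong₂ _-_ V+I≡∑h ∑-image-squares ⟩
    ∑ h - ∑ (λ d → - (d * d) * (℘ d * ℘ d))             ≡⟨ cong (∑ h +_) (sym (∑-neg (λ d → - (d * d) * (℘ d * ℘ d)))) ⟩
    ∑ h + ∑ (λ d → - (- (d * d) * (℘ d * ℘ d)))         ≡⟨ sym (∑-distrib h (λ d → - (- (d * d) * (℘ d * ℘ d)))) ⟩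
    ∑ (λ x → h x + - (- (x * x) * (℘ x * ℘ x)))         ≡⟨ ∑-cong (λ x → cong (h x +_) (solve 2 (λ x P → :- (:- (x :* x) :* P) := x :* x :* P) refl x (℘ x * ℘ x))) ⟩
    ∑ (λ x → h x + (x * x) * (℘ x * ℘ x))               ∎
    where
    V = ∑ (λ γ → when (value? γ) γ)
    I = ∑ (λ x → when (image? x) (x * x))
    V+I≡∑h : V + I ≡ ∑ h
    V+I≡∑h = begin
      V + I                                             ≡⟨ cong (V +_) (sym ∑-surplus) ⟩
      V + ∑ (λ γ → surplus γ · γ)                       ≡⟨ sym (∑-distrib (λ γ → when (value? γ) γ) (λ γ → surplus γ · γ)) ⟩
      ∑ (λ γ → when (value? γ) γ + surplus γ · γ)       ≡⟨ ∑-cong split ⟩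
      ∑ (λ γ → #h⁻¹ γ · γ)                              ≡⟨ ∑-preimages ⟩
      ∑ h                                               ∎
      where
      split : ∀ γ → when (value? γ) γ + surplus γ · γ ≡ #h⁻¹ γ · γ
      split γ = sym (begin
        #h⁻¹ γ · γ                                      ≡⟨ cong (_· γ) (#h⁻¹-split γ) ⟩
        (𝟙 (value? γ) N.+ surplus γ) · γ                 ≡⟨ ×-homo-+ γ (𝟙 (value? γ)) (surplus γ) ⟩
        𝟙 (value? γ) · γ + surplus γ · γ                 ≡⟨ cong (_+ surplus γ · γ) (𝟙·≡when (value? γ) γ) ⟩
        when (value? γ) γ + surplus γ · γ                ∎)

  ∑-values≡power-sums : ∑ (λ γ → when (value? γ) γ) ≡ ∑ (_^ 2) + (∑ (_^ 3) + (∑ (_^ 4) + (∑ (_^ 6) + ∑ (_^ 8))))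
  ∑-values≡power-sums = begin
    ∑ (λ γ → when (value? γ) γ)                                     ≡⟨ ∑-values ⟩
    ∑ (λ x → h x + (x * x) * (℘ x * ℘ x))                           ≡⟨ ∑-cong expand ⟩
    ∑ (λ x → x ^ 2 + (x ^ 3 + (x ^ 4 + (x ^ 6 + x ^ 8))))           ≡⟨ ∑-distrib (_^ 2) (λ x → x ^ 3 + (x ^ 4 + (x ^ 6 + x ^ 8))) ⟩
    ∑ (_^ 2) + ∑ (λ x → x ^ 3 + (x ^ 4 + (x ^ 6 + x ^ 8)))          ≡⟨ cong (∑ (_^ 2) +_) (∑-distrib (_^ 3) (λ x → x ^ 4 + (x ^ 6 + x ^ 8))) ⟩
    ∑ (_^ 2) + (∑ (_^ 3) + ∑ (λ x → x ^ 4 + (x ^ 6 + x ^ 8)))       ≡⟨ cong (λ z → ∑ (_^ 2) + (∑ (_^ 3) + z)) (∑-distrib (_^ 4) (λ x → x ^ 6 + x ^ 8)) ⟩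
    ∑ (_^ 2) + (∑ (_^ 3) + (∑ (_^ 4) + ∑ (λ x → x ^ 6 + x ^ 8)))    ≡⟨ cong (λ z → ∑ (_^ 2) + (∑ (_^ 3) + (∑ (_^ 4) + z))) (∑-distrib (_^ 6) (_^ 8)) ⟩
    ∑ (_^ 2) + (∑ (_^ 3) + (∑ (_^ 4) + (∑ (_^ 6) + ∑ (_^ 8))))      ∎
    where
    expand : ∀ x → h x + (x * x) * (℘ x * ℘ x) ≡ x ^ 2 + (x ^ 3 + (x ^ 4 + (x ^ 6 + x ^ 8)))
    expand = solve 1 (λ x → (x :^ 3 :+ x :^ 2) :+ (x :* x) :* ((x :^ 3 :- x) :* (x :^ 3 :- x))
                          := x :^ 2 :+ (x :^ 3 :+ (x :^ 4 :+ (x :^ 6 :+ x :^ 8)))) refl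

  ∑-values≡0 : 27 ≤ 3 N.^ suc j → ∑ (λ γ → when (value? γ) γ) ≡ 0#
  ∑-values≡0 27≤q = begin
    ∑ (λ γ → when (value? γ) γ)                                      ≡⟨ ∑-values≡power-sums ⟩
    ∑ (_^ 2) + (∑ (_^ 3) + (∑ (_^ 4) + (∑ (_^ 6) + ∑ (_^ 8))))       ≡⟨ cong₂ _+_ (vanish 2) (cong₂ _+_ (vanish 3) (cong₂ _+_ (vanish 4) (cong₂ _+_ (vanish 6) (vanish 8)))) ⟩
    0# + (0# + (0# + (0# + 0#)))                                    ≡⟨ solve 0 (con 0 :+ (con 0 :+ (con 0 :+ (con 0 :+ con 0))) := con 0) refl ⟩
    0#                                                              ∎
    where
    vanish : ∀ m .{{_ : N.NonZero m}} → {m≤8 : T (m N.≤ᵇ 8)} → ∑ (_^ m) ≡ 0#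
    vanish m {m≤8} = ∑-pow-small m (N.>-nonZero⁻¹ m) (NP.≤-trans (s≤s (s≤s (NP.≤ᵇ⇒≤ m 8 m≤8))) (NP.≤-trans (NP.m≤m+n 10 17) 27≤q))

  ∑-values≡-1 : 3 N.^ suc j ≡ 3 ⊎ 3 N.^ suc j ≡ 9 → ∑ (λ γ → when (value? γ) γ) ≡ - 1#
  ∑-values≡-1 (inj₁ q≡3) = begin
    ∑ (λ γ → when (value? γ) γ)                                      ≡⟨ ∑-values ⟩
    ∑ (λ x → h x + (x * x) * (℘ x * ℘ x))                            ≡⟨ ∑-cong (λ x → cong (λ z → h x + (x * x) * (z * z)) (℘-vanishes x)) ⟩
    ∑ (λ x → h x + (x * x) * (0# * 0#))                              ≡⟨ ∑-cong (λ x → solve 1 (λ x → (x :^ 3 :+ x :^ 2) :+ (x :* x) :* (con 0 :* con 0) := x :^ 3 :+ x :^ 2) refl x) ⟩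
    ∑ h                                                              ≡⟨ ∑-distrib (_^ 3) (_^ 2) ⟩
    ∑ (_^ 3) + ∑ (_^ 2)                                              ≡⟨ cong₂ _+_ (trans (∑-cong (λ x → trans (x³≡x x) (sym (*-identityʳ x))))
                                                                                        (∑-pow-small 1 (s≤s z≤n) (subst (2 <_) (sym q≡3) (NP.n<1+n 2))))
                                                                                 (subst (λ m → ∑ (_^ m) ≡ - 1#) units≡2 ∑-pow-units) ⟩
    0# + - 1#                                                        ≡⟨ +-identityˡ _ ⟩
    - 1#                                                             ∎
    where
    x³≡x : ∀ x → x ^ 3 ≡ x
    x³≡x x = subst (λ m → x ^ m ≡ x) q≡3 (fermat x)
    ℘-vanishes : ∀ x → ℘ x ≡ 0#
    ℘-vanishes x = x≡y⇒x-y≡0 (x³≡x x)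
    units≡2 : units ≡ 2
    units≡2 = NP.suc-injective (trans 1+units≡q q≡3)
  ∑-values≡-1 (inj₂ q≡9) = begin
    ∑ (λ γ → when (value? γ) γ)                                      ≡⟨ ∑-values≡power-sums ⟩
    ∑ (_^ 2) + (∑ (_^ 3) + (∑ (_^ 4) + (∑ (_^ 6) + ∑ (_^ 8))))       ≡⟨ cong₂ _+_ (vanish 2) (cong₂ _+_ (vanish 3) (cong₂ _+_ (vanish 4) (cong₂ _+_ (vanish 6) ∑x⁸≡-1))) ⟩
    0# + (0# + (0# + (0# + - 1#)))                                  ≡⟨ solve 0 (con 0 :+ (con 0 :+ (con 0 :+ (con 0 :+ :- con 1))) := :- con 1) refl ⟩
    - 1#                                                            ∎
    where
    vanish : ∀ m .{{_ : N.NonZero m}} → {m≤7 : T (m N.≤ᵇ 7)} → ∑ (_^ m) ≡ 0#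
    vanish m {m≤7} = ∑-pow-small m (N.>-nonZero⁻¹ m) (subst (suc m <_) (sym q≡9) (s≤s (s≤s (NP.≤ᵇ⇒≤ m 7 m≤7))))
    ∑x⁸≡-1 : ∑ (_^ 8) ≡ - 1#
    ∑x⁸≡-1 = subst (λ m → ∑ (_^ m) ≡ - 1#) (NP.suc-injective (trans 1+units≡q q≡9)) ∑-pow-units

  #preimages≡#h⁻¹ : ∀ γ → #preimages γ ≡ #h⁻¹ γ
  #preimages≡#h⁻¹ γ = length-filter (λ x → h x ≟ γ)

  inValueSet⇔value : ∀ γ → (#preimages γ ≢ 0) ⇔ (#h⁻¹ γ ≢ 0)
  inValueSet⇔value γ = mk⇔ (subst (λ n → n ≢ 0) (#preimages≡#h⁻¹ γ)) (subst (λ n → n ≢ 0) (sym (#preimages≡#h⁻¹ γ)))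

  3·|valueSet|≡2q : 3 N.* length valueSet ≡ 2 N.* 3 N.^ suc j
  3·|valueSet|≡2q = trans (cong (3 N.*_) (trans (length-filter (λ γ → ¬? (#preimages γ N.≟ 0)))
                                                (count-⇔ (λ γ → ¬? (#preimages γ N.≟ 0)) value? inValueSet⇔value)))
                          3·|values|≡2q

  S≡∑values : S ≡ ∑ (λ γ → when (value? γ) γ)
  S≡∑values = trans (foldr-filter (λ γ → ¬? (#preimages γ N.≟ 0)) (λ γ → γ))
                    (∑-when-⇔ (λ γ → ¬? (#preimages γ N.≟ 0)) value? inValueSet⇔value (λ γ → γ))

  S≡0 : 2 < suc j → S ≡ 0#
  S≡0 2<k = trans S≡∑values (∑-values≡0 (27≤3^[1+j] j 2<k))

  S≡-1 : suc j ≤ 2 → S ≡ - 1#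
  S≡-1 k≤2 = trans S≡∑values (∑-values≡-1 (3^[1+j]∈3,9 j k≤2))

  1<#preimages⇔ : ∀ γ → 1 < #preimages γ ⇔ Σ Carrier (λ δ → (γ ≡ δ * δ) × (trace (suc j) δ ≡ 0#))
  1<#preimages⇔ γ = mk⇔ (to (classify γ) ∘ subst (1 <_) (#preimages≡#h⁻¹ γ)) (subst (1 <_) (sym (#preimages≡#h⁻¹ γ)) ∘ from)
    where
    to : Preimages γ → 1 < #h⁻¹ γ → Σ Carrier (λ δ → (γ ≡ δ * δ) × (trace (suc j) δ ≡ 0#))
    to (zero-value γ≡0 _) _ = 0# , trans γ≡0 (sym (zeroˡ 0#)) , Equivalence.to (image⇔kernel 0#) (0# , ℘0≡0)
    to (℘²-value d _ γ≡℘² _) _ = ℘ d , γ≡℘² , trace-℘≡0 d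
    to (other-value _ #≤1) 1<# = contradiction (NP.<-≤-trans 1<# #≤1) (NP.<-irrefl refl)
    from : Σ Carrier (λ δ → (γ ≡ δ * δ) × (trace (suc j) δ ≡ 0#)) → 1 < #h⁻¹ γ
    from (δ , γ≡δ² , trδ≡0) = cases (Equivalence.from (image⇔kernel δ) trδ≡0)
      where
      cases : Image δ → 1 < #h⁻¹ γ
      cases (d , ℘d≡δ) = by (℘ d ≟ 0#)
        where
        γ≡℘² : γ ≡ ℘ d * ℘ d
        γ≡℘² = trans γ≡δ² (cong (λ z → z * z) (sym ℘d≡δ))
        by : Dec (℘ d ≡ 0#) → 1 < #h⁻¹ γ
        by (yes ℘d≡0) = subst (1 <_) (sym (trans (cong #h⁻¹ (trans γ≡℘² (trans (cong (_* ℘ d) ℘d≡0) (zeroˡ (℘ d))))) #h⁻¹0≡2))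
                              (s≤s (s≤s z≤n))
        by (no ℘d≢0) = subst (1 <_) (sym (trans (cong #h⁻¹ γ≡℘²) (#h⁻¹℘²≡3 ℘d≢0))) (s≤s (s≤s z≤n))

  #preimages≡3⇔ : ∀ γ δ → γ ≡ δ * δ → trace (suc j) δ ≡ 0# → (#preimages γ ≡ 3 ⇔ δ ≢ 0#)
  #preimages≡3⇔ γ δ γ≡δ² trδ≡0 = mk⇔ (to ∘ trans (sym (#preimages≡#h⁻¹ γ))) (trans (#preimages≡#h⁻¹ γ) ∘ from)
    where
    to : #h⁻¹ γ ≡ 3 → δ ≢ 0#
    to #≡3 δ≡0 = contradiction (trans (sym #≡3) (trans (cong #h⁻¹ γ≡0) #h⁻¹0≡2)) λ ()
      where
      γ≡0 : γ ≡ 0#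
      γ≡0 = trans γ≡δ² (trans (cong (λ z → z * z) δ≡0) (zeroˡ 0#))
    from : δ ≢ 0# → #h⁻¹ γ ≡ 3
    from δ≢0 with Equivalence.from (image⇔kernel δ) trδ≡0
    ... | d , ℘d≡δ = trans (cong #h⁻¹ (trans γ≡δ² (cong (λ z → z * z) (sym ℘d≡δ))))
                           (#h⁻¹℘²≡3 (λ ℘d≡0 → δ≢0 (trans (sym ℘d≡δ) ℘d≡0)))

lemma4p2 : (k : ℕ) → 1 N.≤ k → (F : FiniteField (3 N.^ k)) →
    let open FiniteField F in
      ((γ : Carrier) →
        (1 N.< #preimages γ ⇔ Σ Carrier (λ δ → (γ ≡ δ * δ) × (trace k δ ≡ 0#))))
      × ((γ δ : Carrier) → γ ≡ δ * δ → trace k δ ≡ 0# →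
          (#preimages γ ≡ 3 ⇔ (¬ (δ ≡ 0#))))
      × (3 N.* length valueSet ≡ 2 N.* 3 N.^ k)
      × (2 N.< k → S ≡ 0#)
      × (k N.≤ 2 → S ≡ - 1#)
lemma4p2 zero () F
lemma4p2 (suc j) _ F =
  1<#preimages⇔ ,
  #preimages≡3⇔ ,
  3·|valueSet|≡2q ,
  S≡0 ,
  S≡-1
  where open PowerOfThree j F
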